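{- Let $A, C \in \mathbb{F}_3[T]$ be nonzero polynomials with $\deg A > \deg C$ and such that $C$ divides $A$. Let $\beta \in \mathbb{F}_3((T^{ -1}))$ be the irrational solution of $-\beta^{4} - A\beta + C = 0$ satisfying $|\beta| < 1$. Then the continued fraction expansion of $\beta$ is $\beta = [b_0, b_1, \ldots, b_n, \ldots]$ with $b_0 = 0$, $b_1 = A/C$, and for all $n \geq 2$, $$b_n = \left(\frac{A}{C}\right)^{3^{n-1}} C^{\frac{3^{n-1} + (-1)^n}{4}}.$$ Furthermore, $\nu(\beta) = 4$.
   Context: $\mathbb{F}_3$ is the field with three elements, $\mathbb{F}_3((T^{ -1}))$ the field of formal power series in $1/T$, with the absolute value $|x| = |T|^{\deg x}$ extending $|P/Q| = |T|^{\deg P - \deg Q}$ on $\mathbb{F}_3(T)$, where $|T|>1$ is a fixed real number. Every irrational $x$ has a continued fraction expansion $x=[a_0,a_1,a_2,\ldots]$ with $a_i \in \mathbb{F}_3[T]$ and $\deg a_i > 0$ for $i \ge 1$. The irrationality measure (approximation exponent) of an irrational $x$ is $\nu(x) = -\limsup_{|Q|\to\infty} \log|x - P/Q| / \log|Q|$, where $P,Q \in \mathbb{F}_3[T]$. -}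

module Defs where

open import Data.Nat as ℕ using (ℕ; zero; suc)
open import Data.Nat.DivMod as ℕD using ()
open import Data.Fin using (Fin; toℕ)
open import Data.Integer as ℤ using (ℤ; +_; ∣_∣)
open import Data.Integer.DivMod as ℤD using ()
open import Data.Integer.Properties using () renaming (_≤?_ to _≤ℤ?_)
open import Data.Product using (Σ; _×_; ∃)
open import Relation.Nullary using (¬_; yes; no)
open import Relation.Binary.PropositionalEquality using (_≡_)

F₃ : Set
F₃ = Fin 3

0F 1F : F₃
0F = Fin.zero where import Data.Fin as Fin
1F = Fin.suc Fin.zero where import Data.Fin as Fin

_+₃_ _*₃_ : F₃ → F₃ → F₃
a +₃ b = (toℕ a ℕ.+ toℕ b) ℕD.mod 3
a *₃ b = (toℕ a ℕ.* toℕ b) ℕD.mod 3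

-₃_ : F₃ → F₃
-₃ a = (2 ℕ.* toℕ a) ℕD.mod 3

-- Formal Laurent series in 1/T over F₃:  x = Σ_{k ≥ 0} coeff k · T^(top - k)

record Laurent : Set where
  constructor mkL
  field
    top   : ℤ
    coeff : ℕ → F₃
open Laurent public

coefAt : Laurent → ℤ → F₃
coefAt x n with n ≤ℤ? top x
... | yes _ = coeff x ∣ top x ℤ.- n ∣
... | no  _ = 0F

infix 4 _≈_
_≈_ : Laurent → Laurent → Set
x ≈ y = ∀ (n : ℤ) → coefAt x n ≡ coefAt y n

0L 1L : Laurent
0L = mkL (+ 0) (λ _ → 0F)
1L = mkL (+ 0) (λ { zero → 1F ; (suc _) → 0F })

infixl 6 _+L_ _-L_
infixl 7 _*L_
infixr 8 _^L_

_+L_ : Laurent → Laurent → Laurent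
x +L y = mkL t (λ k → coefAt x (t ℤ.- + k) +₃ coefAt y (t ℤ.- + k))
  where t = top x ℤ.⊔ top y

-L_ : Laurent → Laurent
-L x = mkL (top x) (λ k → -₃ coeff x k)

_-L_ : Laurent → Laurent → Laurent
x -L y = x +L (-L y)

sumTo : (ℕ → F₃) → ℕ → F₃
sumTo f zero    = f zero
sumTo f (suc k) = sumTo f k +₃ f (suc k)

_*L_ : Laurent → Laurent → Laurent
x *L y = mkL (top x ℤ.+ top y)
             (λ k → sumTo (λ i → coeff x i *₃ coeff y (k ℕ.∸ i)) k)

_^L_ : Laurent → ℕ → Laurent
x ^L zero  = 1L
x ^L suc n = x *L (x ^L n)

IsPoly : Laurent → Set
IsPoly x = ∀ (n : ℤ) → n ℤ.< + 0 → coefAt x n ≡ 0F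

-- |x| < 1 : no coefficients at nonnegative powers of T
SmallL : Laurent → Set
SmallL x = ∀ (n : ℤ) → + 0 ℤ.≤ n → coefAt x n ≡ 0F

Deg : Laurent → ℤ → Set
Deg x d = (¬ coefAt x d ≡ 0F) × (∀ (m : ℤ) → d ℤ.< m → coefAt x m ≡ 0F)

Irrational : Laurent → Set
Irrational x = ∀ (P Q : Laurent) → IsPoly P → IsPoly Q → ¬ (Q ≈ 0L) → ¬ (Q *L x ≈ P)

-- Continued fraction expansion x = [b 0, b 1, ...], defined by the
-- algorithm: x₀ = x, b n = polynomial part of xₙ, x_{n+1} = 1/(xₙ - b n).

IsCFExpansion : Laurent → (ℕ → Laurent) → Set
IsCFExpansion x b =
  Σ (ℕ → Laurent) λ xs →
    (xs 0 ≈ x) ×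
    (∀ (n : ℕ) → IsPoly (b n) × SmallL (xs n -L b n)
                 × ((xs n -L b n) *L xs (suc n) ≈ 1L))

-- The quality of P/Q is
--   -log|x - P/Q| / log|Q| = (deg Q - deg(Qx - P)) / deg Q.
-- ν(x) = ν means limsup_{deg Q → ∞} of this quality equals ν, i.e.
-- for every ε = 1/(k+1):
--  (i) eventually (deg Q ≥ N) the quality is ≤ ν + ε, and
--  (ii) for arbitrarily large deg Q the quality is ≥ ν - ε.

IrrMeasureIs : Laurent → ℕ → Set
IrrMeasureIs x ν =
  (∀ (k : ℕ) → ∃ λ (N : ℤ) → ∀ (P Q : Laurent) (dQ d : ℤ) →
      IsPoly P → IsPoly Q → Deg Q dQ → Deg (Q *L x -L P) d → N ℤ.≤ dQ →
      + suc k ℤ.* (dQ ℤ.- d) ℤ.≤ (+ (suc k ℕ.* ν ℕ.+ 1)) ℤ.* dQ)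
  ×
  (∀ (k : ℕ) (N : ℤ) → Σ Laurent λ P → Σ Laurent λ Q → Σ ℤ λ dQ → Σ ℤ λ d →
      IsPoly P × IsPoly Q × Deg Q dQ × Deg (Q *L x -L P) d × N ℤ.≤ dQ ×
      ((+ (suc k ℕ.* ν) ℤ.- + 1) ℤ.* dQ ℤ.≤ + suc k ℤ.* (dQ ℤ.- d)))

expC : ℕ → ℕ
expC n = ∣ ((+ (3 ℕ.^ (n ℕ.∸ 1))) ℤ.+ (ℤ.- (+ 1)) ℤ.^ n) ℤD./ (+ 4) ∣

bSeq : Laurent → Laurent → ℕ → Laurent
bSeq D C zero          = 0L
bSeq D C (suc zero)    = D
bSeq D C n@(suc (suc _)) = (D ^L (3 ℕ.^ (n ℕ.∸ 1))) *L (C ^L expC n)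

-- In characteristic 3 cubing is a ring endomorphism, so raising β (A + β³) = C to the power 3ⁿ
-- gives β^(3ⁿ) (A^(3ⁿ) + β^(3ⁿ⁺¹)) = C^(3ⁿ). With D = A/C and cₙ + cₙ₊₁ = 3ⁿ this identity says
-- exactly that xₙ = bₙ + β^(3ⁿ) / C^(cₙ) satisfies (xₙ - bₙ) xₙ₊₁ = 1, and |β^(3ⁿ) / C^(cₙ)| < 1,
-- so the xₙ are the complete quotients of β.
--
-- For ν(β) ≤ 4, Liouville's argument: the norm form -P⁴ - APQ³ + CQ⁴ is a polynomial equal to
-- Qβ - P times a cofactor of degree deg A + 3 deg Q, so its degree is ≥ 0. For ν(β) ≥ 4,
-- approximations C X / Q with |Qβ - C X| = |T|^-(3 deg Q + deg A - deg C) are built by cubing: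
-- using β³ = C/β - A and A = C D, the cube of an error reappears, up to the factor -β, as the
-- next error, and two such half steps give the next approximation.

module Submission where

open import Defs
open import Data.Nat as ℕ using (ℕ; zero; suc; _∸_; z≤n; s≤s)
import Data.Nat.Properties as ℕP
import Data.Nat.DivMod as ℕD
open import Data.Integer as ℤ using (ℤ; +_; -[1+_]; _+_; _-_; -_; _≤_; _<_; ∣_∣; _⊔_)
import Data.Integer.Properties as ℤP
open import Data.Integer.Solver using (module +-*-Solver)
open import Data.Fin using () renaming (zero to fz; suc to fs)
open import Data.Fin.Properties using (all?) renaming (_≟_ to _≟₃_)
open import Data.List using (List; []; _∷_)
open import Data.Maybe using (Maybe; just; nothing)
open import Data.Vec using (Vec; lookup)
open import Data.Product using (Σ; _×_; _,_; proj₁; proj₂; ∃)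
open import Data.Sum using (_⊎_; inj₁; inj₂)
open import Data.Empty using (⊥-elim)
open import Relation.Nullary using (¬_; Dec; yes; no)
open import Relation.Nullary.Decidable using (from-yes)
open import Relation.Binary.PropositionalEquality
open import Relation.Binary.Definitions using (tri<; tri≈; tri>)
import Relation.Binary.Reflection as Reflection
import Relation.Binary.Reasoning.Setoid as SetoidReasoning
open import Algebra.Bundles using (CommutativeRing; RawRing)
open import Algebra.Solver.Ring.AlmostCommutativeRing using (fromCommutativeRing; _-Raw-AlmostCommutative⟶_)
import Algebra.Solver.Ring as RingSolver

open +-*-Solver using (solve; _:+_; _:-_; _:*_; :-_; _:=_; con)

Series : Set
Series = ℕ → F₃

+₃-comm : ∀ a b → a +₃ b ≡ b +₃ a
+₃-comm = from-yes (all? λ a → all? λ b → a +₃ b ≟₃ b +₃ a)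

+₃-assoc : ∀ a b c → (a +₃ b) +₃ c ≡ a +₃ (b +₃ c)
+₃-assoc = from-yes (all? λ a → all? λ b → all? λ c → (a +₃ b) +₃ c ≟₃ a +₃ (b +₃ c))

+₃-interchange : ∀ a b c d → (a +₃ b) +₃ (c +₃ d) ≡ (a +₃ c) +₃ (b +₃ d)
+₃-interchange = from-yes (all? λ a → all? λ b → all? λ c → all? λ d →
  (a +₃ b) +₃ (c +₃ d) ≟₃ (a +₃ c) +₃ (b +₃ d))

+₃-identityˡ : ∀ a → 0F +₃ a ≡ a
+₃-identityˡ = from-yes (all? λ a → 0F +₃ a ≟₃ a)

+₃-identityʳ : ∀ a → a +₃ 0F ≡ a
+₃-identityʳ = from-yes (all? λ a → a +₃ 0F ≟₃ a)

-₃-inverseˡ : ∀ a → (-₃ a) +₃ a ≡ 0F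
-₃-inverseˡ = from-yes (all? λ a → (-₃ a) +₃ a ≟₃ 0F)

*₃-comm : ∀ a b → a *₃ b ≡ b *₃ a
*₃-comm = from-yes (all? λ a → all? λ b → a *₃ b ≟₃ b *₃ a)

*₃-assoc : ∀ a b c → (a *₃ b) *₃ c ≡ a *₃ (b *₃ c)
*₃-assoc = from-yes (all? λ a → all? λ b → all? λ c → (a *₃ b) *₃ c ≟₃ a *₃ (b *₃ c))

*₃-distribˡ-+₃ : ∀ a b c → a *₃ (b +₃ c) ≡ (a *₃ b) +₃ (a *₃ c)
*₃-distribˡ-+₃ = from-yes (all? λ a → all? λ b → all? λ c → a *₃ (b +₃ c) ≟₃ (a *₃ b) +₃ (a *₃ c))

*₃-identityˡ : ∀ a → 1F *₃ a ≡ a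
*₃-identityˡ = from-yes (all? λ a → 1F *₃ a ≟₃ a)

*₃-zeroˡ : ∀ a → 0F *₃ a ≡ 0F
*₃-zeroˡ = from-yes (all? λ a → 0F *₃ a ≟₃ 0F)

*₃-zeroʳ : ∀ a → a *₃ 0F ≡ 0F
*₃-zeroʳ = from-yes (all? λ a → a *₃ 0F ≟₃ 0F)

-₃a≡0⇒a≡0 : ∀ a → -₃ a ≡ 0F → a ≡ 0F
-₃a≡0⇒a≡0 fz            _ = refl
-₃a≡0⇒a≡0 (fs fz)       ()
-₃a≡0⇒a≡0 (fs (fs fz))  ()

a*₃b≢0 : ∀ a b → ¬ a ≡ 0F → ¬ b ≡ 0F → ¬ a *₃ b ≡ 0F
a*₃b≢0 fz           _            a≢0 _   = a≢0
a*₃b≢0 (fs fz)      fz           _   b≢0 = b≢0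
a*₃b≢0 (fs (fs fz)) fz           _   b≢0 = b≢0
a*₃b≢0 (fs fz)      (fs fz)      _   _   ()
a*₃b≢0 (fs fz)      (fs (fs fz)) _   _   ()
a*₃b≢0 (fs (fs fz)) (fs fz)      _   _   ()
a*₃b≢0 (fs (fs fz)) (fs (fs fz)) _   _   ()

a*₃a≡1 : ∀ a → ¬ a ≡ 0F → a *₃ a ≡ 1F
a*₃a≡1 fz           a≢0 = ⊥-elim (a≢0 refl)
a*₃a≡1 (fs fz)      _   = refl
a*₃a≡1 (fs (fs fz)) _   = refl

a*₃[-a*₃s]+₃s≡0 : ∀ a s → ¬ a ≡ 0F → (a *₃ (-₃ (a *₃ s))) +₃ s ≡ 0F
a*₃[-a*₃s]+₃s≡0 fz           _ a≢0 = ⊥-elim (a≢0 refl)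
a*₃[-a*₃s]+₃s≡0 (fs fz)      s _   = from-yes (all? λ s → (1F *₃ (-₃ (1F *₃ s))) +₃ s ≟₃ 0F) s
a*₃[-a*₃s]+₃s≡0 (fs (fs fz)) s _   = from-yes (all? λ s → (fs (fs fz) *₃ (-₃ (fs (fs fz) *₃ s))) +₃ s ≟₃ 0F) s

sumTo-cong : ∀ (f g : Series) k → (∀ i → i ℕ.≤ k → f i ≡ g i) → sumTo f k ≡ sumTo g k
sumTo-cong f g zero    f≗g = f≗g zero z≤n
sumTo-cong f g (suc k) f≗g =
  cong₂ _+₃_ (sumTo-cong f g k (λ i i≤k → f≗g i (ℕP.m≤n⇒m≤1+n i≤k))) (f≗g (suc k) ℕP.≤-refl)

sumTo-+₃ : ∀ (f g : Series) k → sumTo (λ i → f i +₃ g i) k ≡ sumTo f k +₃ sumTo g k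
sumTo-+₃ f g zero    = refl
sumTo-+₃ f g (suc k) = trans (cong (_+₃ (f (suc k) +₃ g (suc k))) (sumTo-+₃ f g k))
                             (+₃-interchange (sumTo f k) (sumTo g k) (f (suc k)) (g (suc k)))

*₃-sumTo : ∀ a (f : Series) k → a *₃ sumTo f k ≡ sumTo (λ i → a *₃ f i) k
*₃-sumTo a f zero    = refl
*₃-sumTo a f (suc k) = trans (*₃-distribˡ-+₃ a (sumTo f k) (f (suc k)))
                             (cong (_+₃ (a *₃ f (suc k))) (*₃-sumTo a f k))

sumTo-suc : ∀ (f : Series) k → sumTo f (suc k) ≡ f 0 +₃ sumTo (λ i → f (suc i)) k
sumTo-suc f zero    = refl
sumTo-suc f (suc k) = trans (cong (_+₃ f (suc (suc k))) (sumTo-suc f k))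
                            (+₃-assoc (f 0) (sumTo (λ i → f (suc i)) k) (f (suc (suc k))))

sumTo-zero : ∀ (f : Series) k → (∀ i → i ℕ.≤ k → f i ≡ 0F) → sumTo f k ≡ 0F
sumTo-zero f zero    f≡0 = f≡0 zero z≤n
sumTo-zero f (suc k) f≡0 =
  cong₂ _+₃_ (sumTo-zero f k (λ i i≤k → f≡0 i (ℕP.m≤n⇒m≤1+n i≤k))) (f≡0 (suc k) ℕP.≤-refl)

sumTo-reverse : ∀ (f : Series) k → sumTo f k ≡ sumTo (λ i → f (k ∸ i)) k
sumTo-reverse f zero    = refl
sumTo-reverse f (suc k) = begin
  sumTo f k +₃ f (suc k)                    ≡⟨ cong (_+₃ f (suc k)) (sumTo-reverse f k) ⟩
  sumTo (λ i → f (k ∸ i)) k +₃ f (suc k)    ≡⟨ +₃-comm _ (f (suc k)) ⟩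
  f (suc k) +₃ sumTo (λ i → f (k ∸ i)) k    ≡⟨ sumTo-suc (λ i → f (suc k ∸ i)) k ⟨
  sumTo (λ i → f (suc k ∸ i)) (suc k)       ∎
  where open ≡-Reasoning

infixl 7 _⋆_
_⋆_ : Series → Series → Series
(a ⋆ b) k = sumTo (λ i → a i *₃ b (k ∸ i)) k

⋆-suc : ∀ a b k → (a ⋆ b) (suc k) ≡ (a 0 *₃ b (suc k)) +₃ ((λ i → a (suc i)) ⋆ b) k
⋆-suc a b k = sumTo-suc (λ i → a i *₃ b (suc k ∸ i)) k

⋆-congˡ : ∀ {a a'} b → (∀ i → a i ≡ a' i) → ∀ k → (a ⋆ b) k ≡ (a' ⋆ b) k
⋆-congˡ b a≗a' k = sumTo-cong _ _ k (λ i _ → cong (_*₃ b (k ∸ i)) (a≗a' i))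

⋆-comm : ∀ a b k → (a ⋆ b) k ≡ (b ⋆ a) k
⋆-comm a b k = trans (sumTo-reverse _ k) (sumTo-cong _ _ k λ i i≤k →
  trans (cong (a (k ∸ i) *₃_) (cong b (ℕP.m∸[m∸n]≡n i≤k))) (*₃-comm (a (k ∸ i)) (b i)))

⋆-distribʳ-+₃ : ∀ a a' b k → ((λ i → a i +₃ a' i) ⋆ b) k ≡ (a ⋆ b) k +₃ (a' ⋆ b) k
⋆-distribʳ-+₃ a a' b k = trans (sumTo-cong _ _ k λ i _ → distribʳ (b (k ∸ i)) (a i) (a' i))
                               (sumTo-+₃ (λ i → a i *₃ b (k ∸ i)) (λ i → a' i *₃ b (k ∸ i)) k)
  where
  distribʳ : ∀ c x y → (x +₃ y) *₃ c ≡ (x *₃ c) +₃ (y *₃ c)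
  distribʳ = from-yes (all? λ c → all? λ x → all? λ y → (x +₃ y) *₃ c ≟₃ (x *₃ c) +₃ (y *₃ c))

⋆-distribˡ-+₃ : ∀ a b b' k → (a ⋆ (λ i → b i +₃ b' i)) k ≡ (a ⋆ b) k +₃ (a ⋆ b') k
⋆-distribˡ-+₃ a b b' k = begin
  (a ⋆ (λ i → b i +₃ b' i)) k  ≡⟨ ⋆-comm a (λ i → b i +₃ b' i) k ⟩
  ((λ i → b i +₃ b' i) ⋆ a) k  ≡⟨ ⋆-distribʳ-+₃ b b' a k ⟩
  (b ⋆ a) k +₃ (b' ⋆ a) k      ≡⟨ cong₂ _+₃_ (⋆-comm b a k) (⋆-comm b' a k) ⟩
  (a ⋆ b) k +₃ (a ⋆ b') k      ∎
  where open ≡-Reasoning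

*₃-⋆ : ∀ c a b k → ((λ i → c *₃ a i) ⋆ b) k ≡ c *₃ (a ⋆ b) k
*₃-⋆ c a b k = trans (sumTo-cong _ _ k λ i _ → *₃-assoc c (a i) (b (k ∸ i)))
                     (sym (*₃-sumTo c (λ i → a i *₃ b (k ∸ i)) k))

⋆-assoc : ∀ a b c k → ((a ⋆ b) ⋆ c) k ≡ (a ⋆ (b ⋆ c)) k
⋆-assoc a b c zero    = *₃-assoc (a 0) (b 0) (c 0)
⋆-assoc a b c (suc k) = begin
  ((a ⋆ b) ⋆ c) (suc k)
    ≡⟨ ⋆-suc (a ⋆ b) c k ⟩
  ((a 0 *₃ b 0) *₃ c (suc k)) +₃ ((λ i → (a ⋆ b) (suc i)) ⋆ c) k
    ≡⟨ cong (abc₀ +₃_) (⋆-congˡ c (⋆-suc a b) k) ⟩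
  ((a 0 *₃ b 0) *₃ c (suc k)) +₃ ((λ i → (a 0 *₃ b (suc i)) +₃ (a' ⋆ b) i) ⋆ c) k
    ≡⟨ cong (abc₀ +₃_) (⋆-distribʳ-+₃ (λ i → a 0 *₃ b (suc i)) (a' ⋆ b) c k) ⟩
  ((a 0 *₃ b 0) *₃ c (suc k)) +₃ (((λ i → a 0 *₃ b (suc i)) ⋆ c) k +₃ ((a' ⋆ b) ⋆ c) k)
    ≡⟨ cong₂ (λ u v → abc₀ +₃ (u +₃ v)) (*₃-⋆ (a 0) b' c k) (⋆-assoc a' b c k) ⟩
  ((a 0 *₃ b 0) *₃ c (suc k)) +₃ ((a 0 *₃ (b' ⋆ c) k) +₃ (a' ⋆ (b ⋆ c)) k)
    ≡⟨ +₃-assoc abc₀ (a 0 *₃ (b' ⋆ c) k) ((a' ⋆ (b ⋆ c)) k) ⟨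
  (((a 0 *₃ b 0) *₃ c (suc k)) +₃ (a 0 *₃ (b' ⋆ c) k)) +₃ (a' ⋆ (b ⋆ c)) k
    ≡⟨ cong (_+₃ (a' ⋆ (b ⋆ c)) k) (trans (cong (_+₃ (a 0 *₃ (b' ⋆ c) k)) (*₃-assoc (a 0) (b 0) (c (suc k))))
                                          (sym (*₃-distribˡ-+₃ (a 0) (b 0 *₃ c (suc k)) ((b' ⋆ c) k)))) ⟩
  (a 0 *₃ ((b 0 *₃ c (suc k)) +₃ (b' ⋆ c) k)) +₃ (a' ⋆ (b ⋆ c)) k
    ≡⟨ cong (λ u → (a 0 *₃ u) +₃ (a' ⋆ (b ⋆ c)) k) (⋆-suc b c k) ⟨
  (a 0 *₃ (b ⋆ c) (suc k)) +₃ (a' ⋆ (b ⋆ c)) k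
    ≡⟨ ⋆-suc a (b ⋆ c) k ⟨
  (a ⋆ (b ⋆ c)) (suc k) ∎
  where
  open ≡-Reasoning
  a' b' : Series
  abc₀ : F₃
  abc₀ = (a 0 *₃ b 0) *₃ c (suc k)
  a' i = a (suc i)
  b' i = b (suc i)

⋆-identityˡ : ∀ a k → (coeff 1L ⋆ a) k ≡ a k
⋆-identityˡ a zero    = *₃-identityˡ (a 0)
⋆-identityˡ a (suc k) = begin
  (coeff 1L ⋆ a) (suc k)                   ≡⟨ ⋆-suc (coeff 1L) a k ⟩
  (1F *₃ a (suc k)) +₃ ((λ _ → 0F) ⋆ a) k  ≡⟨ cong ((1F *₃ a (suc k)) +₃_) (sumTo-zero _ k λ i _ → *₃-zeroˡ (a (k ∸ i))) ⟩
  (1F *₃ a (suc k)) +₃ 0F                  ≡⟨ +₃-identityʳ (1F *₃ a (suc k)) ⟩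
  1F *₃ a (suc k)                          ≡⟨ *₃-identityˡ (a (suc k)) ⟩
  a (suc k)                                ∎
  where open ≡-Reasoning

⋆-vanishˡ : ∀ a b k → (∀ i → i ℕ.≤ k → a i ≡ 0F) → (a ⋆ b) k ≡ 0F
⋆-vanishˡ a b k a≡0 = sumTo-zero _ k λ i i≤k → trans (cong (_*₃ b (k ∸ i)) (a≡0 i i≤k)) (*₃-zeroˡ (b (k ∸ i)))

⋆-shiftˡ : ∀ s a b → (∀ i → i ℕ.< s → a i ≡ 0F) → ∀ k → (a ⋆ b) (s ℕ.+ k) ≡ ((λ j → a (s ℕ.+ j)) ⋆ b) k
⋆-shiftˡ zero    a b _   k = refl
⋆-shiftˡ (suc s) a b a≡0 k = begin
  (a ⋆ b) (suc (s ℕ.+ k))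
    ≡⟨ ⋆-suc a b (s ℕ.+ k) ⟩
  (a 0 *₃ b (suc (s ℕ.+ k))) +₃ a'b
    ≡⟨ cong (λ u → (u *₃ b (suc (s ℕ.+ k))) +₃ a'b) (a≡0 0 (s≤s z≤n)) ⟩
  (0F *₃ b (suc (s ℕ.+ k))) +₃ a'b
    ≡⟨ trans (cong (_+₃ a'b) (*₃-zeroˡ (b (suc (s ℕ.+ k))))) (+₃-identityˡ a'b) ⟩
  ((λ i → a (suc i)) ⋆ b) (s ℕ.+ k)
    ≡⟨ ⋆-shiftˡ s (λ i → a (suc i)) b (λ i i<s → a≡0 (suc i) (s≤s i<s)) k ⟩
  ((λ j → a (suc (s ℕ.+ j))) ⋆ b) k ∎
  where
  open ≡-Reasoning
  a'b : F₃
  a'b = ((λ i → a (suc i)) ⋆ b) (s ℕ.+ k)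

⋆-vanish-beyond : ∀ a b p q k → (∀ i → p ℕ.< i → a i ≡ 0F) → (∀ i → q ℕ.< i → b i ≡ 0F) →
                  p ℕ.+ q ℕ.< k → (a ⋆ b) k ≡ 0F
⋆-vanish-beyond a b p q k a≡0 b≡0 p+q<k = sumTo-zero _ k term≡0
  where
  term≡0 : ∀ i → i ℕ.≤ k → a i *₃ b (k ∸ i) ≡ 0F
  term≡0 i i≤k with i ℕ.≤? p
  ... | no  i≰p = trans (cong (_*₃ b (k ∸ i)) (a≡0 i (ℕP.≰⇒> i≰p))) (*₃-zeroˡ (b (k ∸ i)))
  ... | yes i≤p = trans (cong (a i *₃_) (b≡0 (k ∸ i) q<k∸i)) (*₃-zeroʳ (a i))
    where
    q<k∸i : q ℕ.< k ∸ i
    q<k∸i = ℕP.+-cancelˡ-< i q (k ∸ i) (subst (i ℕ.+ q ℕ.<_) (sym (ℕP.m+[n∸m]≡n i≤k))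
                                              (ℕP.≤-<-trans (ℕP.+-monoˡ-≤ q i≤p) p+q<k))

≤⇒≡+ : ∀ {i j} → i ≤ j → Σ ℕ λ k → j ≡ i + + k
≤⇒≡+ {i} {j} i≤j = ∣ i - j ∣ , trans (solve 2 (λ i j → j := i :+ (j :- i)) refl i j)
                                      (cong (λ u → i + u) (sym (ℤP.∣-∣-≤ i≤j)))

≡+⇒≤ : ∀ {i j k} → j ≡ i + + k → i ≤ j
≡+⇒≤ {i} {k = k} refl = ℤP.i≤i+j i (+ k)

<⇒≡+suc : ∀ {i j} → i < j → Σ ℕ λ k → j ≡ i + + suc k
<⇒≡+suc {i} i<j with ≤⇒≡+ (ℤP.i<j⇒suc[i]≤j i<j)
... | k , j≡ = k , trans j≡ (solve 2 (λ i k → (con (+ 1) :+ i) :+ k := i :+ (con (+ 1) :+ k)) refl i (+ k))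

≡+suc⇒< : ∀ {i j k} → j ≡ i + + suc k → i < j
≡+suc⇒< {i} {k = k} j≡ = ℤP.suc[i]≤j⇒i<j (≡+⇒≤ {k = k}
  (trans j≡ (solve 2 (λ i k → i :+ (con (+ 1) :+ k) := (con (+ 1) :+ i) :+ k) refl i (+ k))))

data Position (t n : ℤ) : Set where
  above : t < n → Position t n
  below : (k : ℕ) → n ≡ t - + k → Position t n

position : ∀ t n → Position t n
position t n with n ℤP.≤? t
... | no  n≰t = above (ℤP.≰⇒> n≰t)
... | yes n≤t = below ∣ t - n ∣ (sym (begin
  t - + ∣ t - n ∣  ≡⟨ cong (λ u → t - + u) (ℤP.∣i-j∣≡∣j-i∣ t n) ⟩
  t - + ∣ n - t ∣  ≡⟨ cong (λ u → t - u) (ℤP.∣-∣-≤ n≤t) ⟩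
  t - (t - n)      ≡⟨ solve 2 (λ t n → t :- (t :- n) := n) refl t n ⟩
  n                ∎))
  where open ≡-Reasoning

coefAt-above : ∀ x n → top x < n → coefAt x n ≡ 0F
coefAt-above x n top<n with n ℤP.≤? top x
... | yes n≤top = ⊥-elim (ℤP.<⇒≱ top<n n≤top)
... | no  _     = refl

coefAt-below : ∀ x k → coefAt x (top x - + k) ≡ coeff x k
coefAt-below x k with top x - + k ℤP.≤? top x
... | yes _ = cong (coeff x) (cong ∣_∣ (solve 2 (λ t k → t :- (t :- k) := k) refl (top x) (+ k)))
... | no  n≰top = ⊥-elim (n≰top (ℤP.i-j≤i (top x) (+ k)))

coefAt-+L : ∀ x y n → coefAt (x +L y) n ≡ coefAt x n +₃ coefAt y n
coefAt-+L x y n with position (top x ⊔ top y) n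
... | above t<n = trans (coefAt-above (x +L y) n t<n)
  (sym (cong₂ _+₃_ (coefAt-above x n (ℤP.≤-<-trans (ℤP.i≤i⊔j (top x) (top y)) t<n))
                   (coefAt-above y n (ℤP.≤-<-trans (ℤP.i≤j⊔i (top x) (top y)) t<n))))
... | below k refl = coefAt-below (x +L y) k

coefAt--L : ∀ x n → coefAt (-L x) n ≡ -₃ coefAt x n
coefAt--L x n with n ℤP.≤? top x
... | yes _ = refl
... | no  _ = refl

coefAt-0L : ∀ n → coefAt 0L n ≡ 0F
coefAt-0L n with n ℤP.≤? + 0
... | yes _ = refl
... | no  _ = refl

≈-refl : ∀ {x} → x ≈ x
≈-refl _ = refl

≈-sym : ∀ {x y} → x ≈ y → y ≈ x
≈-sym x≈y n = sym (x≈y n)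

≈-trans : ∀ {x y z} → x ≈ y → y ≈ z → x ≈ z
≈-trans x≈y y≈z n = trans (x≈y n) (y≈z n)

≈-reflexive : ∀ {x y} → x ≡ y → x ≈ y
≈-reflexive refl = ≈-refl

≈-fromCoeff : ∀ x y → top x ≡ top y → (∀ k → coeff x k ≡ coeff y k) → x ≈ y
≈-fromCoeff (mkL t f) (mkL .t g) refl f≗g n with n ℤP.≤? t
... | yes _ = f≗g _
... | no  _ = refl

-- Bound x m : |x| ≤ |T|^m
Bound : Laurent → ℤ → Set
Bound x m = ∀ n → m < n → coefAt x n ≡ 0F

Bound-top : ∀ x → Bound x (top x)
Bound-top = coefAt-above

Bound-mono : ∀ {x m m'} → m ≤ m' → Bound x m → Bound x m'
Bound-mono m≤m' x≤m n m'<n = x≤m n (ℤP.≤-<-trans m≤m' m'<n)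

-- The same series, padded with leading zeros up to T^t when top x ≤ t.
withTop : ℤ → Laurent → Laurent
withTop t x = mkL t (λ i → coefAt x (t - + i))

withTop-≈ : ∀ t x → Bound x t → withTop t x ≈ x
withTop-≈ t x x≡0 n with position t n
... | above t<n = trans (coefAt-above (withTop t x) n t<n) (sym (x≡0 n t<n))
... | below k refl = coefAt-below (withTop t x) k

withTop-padding : ∀ x s i → i ℕ.< s → coeff (withTop (top x + + s) x) i ≡ 0F
withTop-padding x s i i<s with ℕP.m≤n⇒∃[o]m+o≡n i<s
... | d , refl = coefAt-above x _ (≡+suc⇒< {k = d}
  (trans (cong (λ u → top x + u - + i) (ℤP.pos-+ (suc i) d))
         (solve 3 (λ t i d → t :+ ((con (+ 1) :+ i) :+ d) :- i := t :+ (con (+ 1) :+ d)) refl (top x) (+ i) (+ d))))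

withTop-shifted : ∀ x s j → coeff (withTop (top x + + s) x) (s ℕ.+ j) ≡ coeff x j
withTop-shifted x s j = trans (cong (coefAt x) index) (coefAt-below x j)
  where
  index : top x + + s - + (s ℕ.+ j) ≡ top x - + j
  index = trans (cong (λ u → top x + + s - u) (ℤP.pos-+ s j))
                (solve 3 (λ t s j → t :+ s :- (s :+ j) := t :- j) refl (top x) (+ s) (+ j))

withTop-*L : ∀ t x y → top x ≤ t → withTop t x *L y ≈ x *L y
withTop-*L t x y top≤t with ≤⇒≡+ top≤t
... | s , refl = product
  where
  x' : Laurent
  x' = withTop (top x + + s) x
  product : x' *L y ≈ x *L y
  product n with position (top x + top y) n
  ... | below k refl = begin
    coefAt (x' *L y) (top x + top y - + k)            ≡⟨ cong (coefAt (x' *L y)) index ⟩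
    coefAt (x' *L y) (top x + + s + top y - + (s ℕ.+ k)) ≡⟨ coefAt-below (x' *L y) (s ℕ.+ k) ⟩
    (coeff x' ⋆ coeff y) (s ℕ.+ k)                     ≡⟨ ⋆-shiftˡ s (coeff x') (coeff y) (withTop-padding x s) k ⟩
    ((λ j → coeff x' (s ℕ.+ j)) ⋆ coeff y) k           ≡⟨ ⋆-congˡ (coeff y) (withTop-shifted x s) k ⟩
    (coeff x ⋆ coeff y) k                              ≡⟨ coefAt-below (x *L y) k ⟨
    coefAt (x *L y) (top x + top y - + k)              ∎
    where
    open ≡-Reasoning
    index : top x + top y - + k ≡ top x + + s + top y - + (s ℕ.+ k)
    index = trans (solve 4 (λ tx ty s k → tx :+ ty :- k := (tx :+ s) :+ ty :- (s :+ k)) refl (top x) (top y) (+ s) (+ k))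
                  (cong (λ u → top x + + s + top y - u) (sym (ℤP.pos-+ s k)))
  ... | above top<n with position (top x + + s + top y) n
  ...   | above t<n = trans (coefAt-above (x' *L y) n t<n) (sym (coefAt-above (x *L y) n top<n))
  ...   | below K refl = begin
    coefAt (x' *L y) (top x + + s + top y - + K)  ≡⟨ coefAt-below (x' *L y) K ⟩
    (coeff x' ⋆ coeff y) K                        ≡⟨ ⋆-vanishˡ _ (coeff y) K (λ i i≤K → withTop-padding x s i (ℕP.≤-<-trans i≤K K<s)) ⟩
    0F                                            ≡⟨ coefAt-above (x *L y) _ top<n ⟨
    coefAt (x *L y) (top x + + s + top y - + K)   ∎
    where
    open ≡-Reasoning
    K<s : K ℕ.< s
    K<s = ℤP.drop‿+<+ (subst₂ _<_
      (solve 2 (λ txy K → txy :+ (K :- txy) := K) refl (top x + top y) (+ K))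
      (solve 4 (λ tx ty s K → (tx :+ s :+ ty :- K) :+ (K :- (tx :+ ty)) := s) refl (top x) (top y) (+ s) (+ K))
      (ℤP.+-monoˡ-< (+ K - (top x + top y)) top<n))

*L-comm : ∀ x y → x *L y ≈ y *L x
*L-comm x y = ≈-fromCoeff (x *L y) (y *L x) (ℤP.+-comm (top x) (top y)) (⋆-comm (coeff x) (coeff y))

*L-assoc : ∀ x y z → (x *L y) *L z ≈ x *L (y *L z)
*L-assoc x y z = ≈-fromCoeff ((x *L y) *L z) (x *L (y *L z)) (ℤP.+-assoc (top x) (top y) (top z))
                             (⋆-assoc (coeff x) (coeff y) (coeff z))

*L-congʳ : ∀ {x x'} y → x ≈ x' → x *L y ≈ x' *L y
*L-congʳ {x} {x'} y x≈x' =
  ≈-trans (≈-sym (withTop-*L t x y (ℤP.i≤i⊔j (top x) (top x'))))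
          (≈-trans (≈-fromCoeff (withTop t x *L y) (withTop t x' *L y) refl
                                (⋆-congˡ (coeff y) (λ i → x≈x' (t - + i))))
                   (withTop-*L t x' y (ℤP.i≤j⊔i (top x) (top x'))))
  where
  t : ℤ
  t = top x ⊔ top x'

*L-congˡ : ∀ x {y y'} → y ≈ y' → x *L y ≈ x *L y'
*L-congˡ x {y} {y'} y≈y' = ≈-trans (*L-comm x y) (≈-trans (*L-congʳ x y≈y') (*L-comm y' x))

*L-cong : ∀ {x x' y y'} → x ≈ x' → y ≈ y' → x *L y ≈ x' *L y'
*L-cong {x' = x'} {y} x≈x' y≈y' = ≈-trans (*L-congʳ y x≈x') (*L-congˡ x' y≈y')

*L-identityˡ : ∀ x → 1L *L x ≈ x
*L-identityˡ x = ≈-fromCoeff (1L *L x) x (ℤP.+-identityˡ (top x)) λ k →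
  ⋆-identityˡ (coeff x) k

*L-identityʳ : ∀ x → x *L 1L ≈ x
*L-identityʳ x = ≈-trans (*L-comm x 1L) (*L-identityˡ x)

+L-cong : ∀ {x x' y y'} → x ≈ x' → y ≈ y' → x +L y ≈ x' +L y'
+L-cong {x} {x'} {y} {y'} x≈x' y≈y' n =
  trans (coefAt-+L x y n) (trans (cong₂ _+₃_ (x≈x' n) (y≈y' n)) (sym (coefAt-+L x' y' n)))

+L-assoc : ∀ x y z → (x +L y) +L z ≈ x +L (y +L z)
+L-assoc x y z n = begin
  coefAt ((x +L y) +L z) n                   ≡⟨ coefAt-+L (x +L y) z n ⟩
  coefAt (x +L y) n +₃ coefAt z n            ≡⟨ cong (_+₃ coefAt z n) (coefAt-+L x y n) ⟩
  (coefAt x n +₃ coefAt y n) +₃ coefAt z n   ≡⟨ +₃-assoc (coefAt x n) (coefAt y n) (coefAt z n) ⟩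
  coefAt x n +₃ (coefAt y n +₃ coefAt z n)   ≡⟨ cong (coefAt x n +₃_) (coefAt-+L y z n) ⟨
  coefAt x n +₃ coefAt (y +L z) n            ≡⟨ coefAt-+L x (y +L z) n ⟨
  coefAt (x +L (y +L z)) n                   ∎
  where open ≡-Reasoning

+L-comm : ∀ x y → x +L y ≈ y +L x
+L-comm x y n = trans (coefAt-+L x y n) (trans (+₃-comm (coefAt x n) (coefAt y n)) (sym (coefAt-+L y x n)))

+L-identityˡ : ∀ x → 0L +L x ≈ x
+L-identityˡ x n = trans (coefAt-+L 0L x n) (trans (cong (_+₃ coefAt x n) (coefAt-0L n)) (+₃-identityˡ (coefAt x n)))

+L-identityʳ : ∀ x → x +L 0L ≈ x
+L-identityʳ x = ≈-trans (+L-comm x 0L) (+L-identityˡ x)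

-L-cong : ∀ {x y} → x ≈ y → -L x ≈ -L y
-L-cong {x} {y} x≈y n = trans (coefAt--L x n) (trans (cong -₃_ (x≈y n)) (sym (coefAt--L y n)))

-L-inverseˡ : ∀ x → (-L x) +L x ≈ 0L
-L-inverseˡ x n = trans (coefAt-+L (-L x) x n) (trans (cong (_+₃ coefAt x n) (coefAt--L x n))
                        (trans (-₃-inverseˡ (coefAt x n)) (sym (coefAt-0L n))))

-L-inverseʳ : ∀ x → x +L (-L x) ≈ 0L
-L-inverseʳ x = ≈-trans (+L-comm x (-L x)) (-L-inverseˡ x)

*L-distribˡ-+L : ∀ x y z → x *L (y +L z) ≈ (x *L y) +L (x *L z)
*L-distribˡ-+L x y z = ≈-trans aligned (+L-cong (*L-congˡ x (withTop-≈ t y (Bound-mono (ℤP.i≤i⊔j (top y) (top z)) (Bound-top y))))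
                                               (*L-congˡ x (withTop-≈ t z (Bound-mono (ℤP.i≤j⊔i (top y) (top z)) (Bound-top z)))))
  where
  t : ℤ
  t = top y ⊔ top z
  y' z' : Laurent
  y' = withTop t y
  z' = withTop t z
  aligned : x *L (y +L z) ≈ (x *L y') +L (x *L z')
  aligned n with position (top x + t) n
  ... | above t<n = trans (coefAt-above (x *L (y +L z)) n t<n)
                          (sym (trans (coefAt-+L (x *L y') (x *L z') n)
                                      (cong₂ _+₃_ (coefAt-above (x *L y') n t<n) (coefAt-above (x *L z') n t<n))))
  ... | below k refl = begin
    coefAt (x *L (y +L z)) (top x + t - + k)   ≡⟨ coefAt-below (x *L (y +L z)) k ⟩
    (coeff x ⋆ coeff (y +L z)) k               ≡⟨ ⋆-distribˡ-+₃ (coeff x) (coeff y') (coeff z') k ⟩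
    (coeff x ⋆ coeff y') k +₃ (coeff x ⋆ coeff z') k
      ≡⟨ cong₂ _+₃_ (coefAt-below (x *L y') k) (coefAt-below (x *L z') k) ⟨
    coefAt (x *L y') (top x + t - + k) +₃ coefAt (x *L z') (top x + t - + k)
      ≡⟨ coefAt-+L (x *L y') (x *L z') (top x + t - + k) ⟨
    coefAt ((x *L y') +L (x *L z')) (top x + t - + k) ∎
    where open ≡-Reasoning

*L-distribʳ-+L : ∀ x y z → (y +L z) *L x ≈ (y *L x) +L (z *L x)
*L-distribʳ-+L x y z =
  ≈-trans (*L-comm (y +L z) x) (≈-trans (*L-distribˡ-+L x y z) (+L-cong (*L-comm x y) (*L-comm x z)))


-- The ring solver decides an identity by comparing normal forms with refl; evaluating
-- those normal forms through the transparent series operations would force Agda to unfold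
-- the coefficient arithmetic, so the solver works over opaque copies of them.
opaque
  _⊞_ _⊠_ : Laurent → Laurent → Laurent
  x ⊞ y = x +L y
  x ⊠ y = x *L y

  ⊟_ : Laurent → Laurent
  ⊟ x = -L x

  ⊞≈+L : ∀ x y → x ⊞ y ≈ x +L y
  ⊞≈+L _ _ = ≈-refl

  ⊠≈*L : ∀ x y → x ⊠ y ≈ x *L y
  ⊠≈*L _ _ = ≈-refl

  ⊟≈-L : ∀ x → ⊟ x ≈ -L x
  ⊟≈-L _ = ≈-refl

⊞-cong : ∀ {x x' y y'} → x ≈ x' → y ≈ y' → x ⊞ y ≈ x' ⊞ y'
⊞-cong {x} {x'} {y} {y'} x≈x' y≈y' = ≈-trans (⊞≈+L x y) (≈-trans (+L-cong x≈x' y≈y') (≈-sym (⊞≈+L x' y')))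

⊠-cong : ∀ {x x' y y'} → x ≈ x' → y ≈ y' → x ⊠ y ≈ x' ⊠ y'
⊠-cong {x} {x'} {y} {y'} x≈x' y≈y' = ≈-trans (⊠≈*L x y) (≈-trans (*L-cong x≈x' y≈y') (≈-sym (⊠≈*L x' y')))

⊟-cong : ∀ {x y} → x ≈ y → ⊟ x ≈ ⊟ y
⊟-cong {x} {y} x≈y = ≈-trans (⊟≈-L x) (≈-trans (-L-cong x≈y) (≈-sym (⊟≈-L y)))

Laurent-commutativeRing : CommutativeRing _ _
Laurent-commutativeRing = record
  { Carrier = Laurent ; _≈_ = _≈_ ; _+_ = _⊞_ ; _*_ = _⊠_ ; -_ = ⊟_ ; 0# = 0L ; 1# = 1L
  ; isCommutativeRing = record
    { isRing = record
      { +-isAbelianGroup = record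
        { isGroup = record
          { isMonoid = record
            { isSemigroup = record
              { isMagma = record
                { isEquivalence = record { refl = ≈-refl ; sym = ≈-sym ; trans = ≈-trans }
                ; ∙-cong = ⊞-cong }
              ; assoc = λ x y z → via (≈-trans (⊞≈+L (x ⊞ y) z) (+L-cong (⊞≈+L x y) (≈-refl {z}))) (+L-assoc x y z)
                                     (≈-trans (⊞≈+L x (y ⊞ z)) (+L-cong (≈-refl {x}) (⊞≈+L y z))) }
            ; identity = (λ x → ≈-trans (⊞≈+L 0L x) (+L-identityˡ x)) , (λ x → ≈-trans (⊞≈+L x 0L) (+L-identityʳ x)) }
          ; inverse = (λ x → ≈-trans (⊞≈+L (⊟ x) x) (≈-trans (+L-cong (⊟≈-L x) (≈-refl {x})) (-L-inverseˡ x)))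
                    , (λ x → ≈-trans (⊞≈+L x (⊟ x)) (≈-trans (+L-cong (≈-refl {x}) (⊟≈-L x)) (-L-inverseʳ x)))
          ; ⁻¹-cong = ⊟-cong }
        ; comm = λ x y → via (⊞≈+L x y) (+L-comm x y) (⊞≈+L y x) }
      ; *-cong = ⊠-cong
      ; *-assoc = λ x y z → via (≈-trans (⊠≈*L (x ⊠ y) z) (*L-congʳ z (⊠≈*L x y))) (*L-assoc x y z)
                                 (≈-trans (⊠≈*L x (y ⊠ z)) (*L-congˡ x (⊠≈*L y z)))
      ; *-identity = (λ x → ≈-trans (⊠≈*L 1L x) (*L-identityˡ x)) , (λ x → ≈-trans (⊠≈*L x 1L) (*L-identityʳ x))
      ; distrib = (λ x y z → ≈-trans (⊠≈*L x (y ⊞ z)) (≈-trans (*L-congˡ x (⊞≈+L y z))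
                               (≈-trans (*L-distribˡ-+L x y z) (≈-sym (≈-trans (⊞≈+L (x ⊠ y) (x ⊠ z)) (+L-cong (⊠≈*L x y) (⊠≈*L x z)))))))
                , (λ x y z → ≈-trans (⊠≈*L (y ⊞ z) x) (≈-trans (*L-congʳ x (⊞≈+L y z))
                               (≈-trans (*L-distribʳ-+L x y z) (≈-sym (≈-trans (⊞≈+L (y ⊠ x) (z ⊠ x)) (+L-cong (⊠≈*L y x) (⊠≈*L z x))))))) }
    ; *-comm = λ x y → via (⊠≈*L x y) (*L-comm x y) (⊠≈*L y x) } }
  where
  via : ∀ {x y u v} → x ≈ u → u ≈ v → y ≈ v → x ≈ y
  via x≈u u≈v y≈v = ≈-trans x≈u (≈-trans u≈v (≈-sym y≈v))

constL : F₃ → Laurent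
constL a = mkL (+ 0) λ { zero → a ; (suc _) → 0F }

F₃-rawRing : RawRing _ _
F₃-rawRing = record { Carrier = F₃ ; _≈_ = _≡_ ; _+_ = _+₃_ ; _*_ = _*₃_ ; -_ = -₃_ ; 0# = 0F ; 1# = 1F }

constL-*₃ : ∀ a b → constL (a *₃ b) ≈ constL a *L constL b
constL-*₃ a b = ≈-fromCoeff _ _ refl λ
  { zero    → refl
  ; (suc k) → sym (begin
      (coeff (constL a) ⋆ coeff (constL b)) (suc k)
        ≡⟨ ⋆-suc (coeff (constL a)) (coeff (constL b)) k ⟩
      (a *₃ 0F) +₃ ((λ _ → 0F) ⋆ coeff (constL b)) k
        ≡⟨ cong₂ _+₃_ (*₃-zeroʳ a) (⋆-vanishˡ _ (coeff (constL b)) k λ _ _ → refl) ⟩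
      0F ∎) }
  where open ≡-Reasoning

constL-homomorphism : F₃-rawRing -Raw-AlmostCommutative⟶ fromCommutativeRing Laurent-commutativeRing
constL-homomorphism = record
  { ⟦_⟧    = constL
  ; +-homo = λ a b → ≈-trans (≈-fromCoeff _ _ refl λ { zero → refl ; (suc _) → refl }) (≈-sym (⊞≈+L _ _))
  ; *-homo = λ a b → ≈-trans (constL-*₃ a b) (≈-sym (⊠≈*L _ _))
  ; -‿homo = λ a → ≈-trans (≈-fromCoeff _ _ refl λ { zero → refl ; (suc _) → refl }) (≈-sym (⊟≈-L _))
  ; 0-homo = ≈-fromCoeff _ _ refl λ { zero → refl ; (suc _) → refl }
  ; 1-homo = ≈-fromCoeff _ _ refl λ { zero → refl ; (suc _) → refl } }

constL-≟ : ∀ a b → Maybe (constL a ≈ constL b)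
constL-≟ a b with a ≟₃ b
... | yes refl = just ≈-refl
... | no  _    = nothing

module Solver = RingSolver F₃-rawRing (fromCommutativeRing Laurent-commutativeRing) constL-homomorphism constL-≟
open Solver using (Polynomial; op; var; _:^_; [+]; [*])

-- Polynomial expressions read back with the transparent operations.
⟦_⟧L : ∀ {n} → Polynomial n → Vec Laurent n → Laurent
⟦ op [+] p q ⟧L ρ = ⟦ p ⟧L ρ +L ⟦ q ⟧L ρ
⟦ op [*] p q ⟧L ρ = ⟦ p ⟧L ρ *L ⟦ q ⟧L ρ
⟦ Solver.con c ⟧L ρ = constL c
⟦ var x ⟧L      ρ = lookup ρ x
⟦ p :^ n ⟧L     ρ = ⟦ p ⟧L ρ ^L n
⟦ Solver.:- p ⟧L  ρ = -L ⟦ p ⟧L ρ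

⟦⟧≈⟦⟧L : ∀ {n} (p : Polynomial n) ρ → Solver.⟦ p ⟧ ρ ≈ ⟦ p ⟧L ρ
⟦⟧≈⟦⟧L (op [+] p q) ρ = ≈-trans (⊞≈+L _ _) (+L-cong (⟦⟧≈⟦⟧L p ρ) (⟦⟧≈⟦⟧L q ρ))
⟦⟧≈⟦⟧L (op [*] p q) ρ = ≈-trans (⊠≈*L _ _) (*L-cong (⟦⟧≈⟦⟧L p ρ) (⟦⟧≈⟦⟧L q ρ))
⟦⟧≈⟦⟧L (Solver.con c) ρ = ≈-refl
⟦⟧≈⟦⟧L (var x)      ρ = ≈-refl
⟦⟧≈⟦⟧L (p :^ n)     ρ = power n
  where
  power : ∀ n → Solver.⟦ p :^ n ⟧ ρ ≈ ⟦ p ⟧L ρ ^L n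
  power zero    = ≈-refl
  power (suc n) = ≈-trans (⊠≈*L _ _) (*L-cong (⟦⟧≈⟦⟧L p ρ) (power n))
⟦⟧≈⟦⟧L (Solver.:- p)  ρ = ≈-trans (⊟≈-L _) (-L-cong (⟦⟧≈⟦⟧L p ρ))

open Reflection (CommutativeRing.setoid Laurent-commutativeRing) var ⟦_⟧L Solver.⟦_⟧↓
                (λ p ρ → ≈-trans (Solver.correct p ρ) (⟦⟧≈⟦⟧L p ρ))
  using () renaming (solve to solveL; _⊜_ to _⊜_)
open Solver using ()
  renaming (_:+_ to _⊕_; _:*_ to _⊗_; _:-_ to _⊖_; :-_ to ⊝_; _:^_ to _⊛_)

module ≈-Reasoning = SetoidReasoning (CommutativeRing.setoid Laurent-commutativeRing)

*L-zeroʳ : ∀ x → x *L 0L ≈ 0L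
*L-zeroʳ x = ≈-trans (≈-sym (⊠≈*L x 0L)) (CommutativeRing.zeroʳ Laurent-commutativeRing x)

≈+0 : ∀ {x y h} → x ≈ y +L h → h ≈ 0L → x ≈ y
≈+0 {y = y} x≈y+h h≈0 = ≈-trans x≈y+h (≈-trans (+L-cong (≈-refl {y}) h≈0) (+L-identityʳ y))

Bound-≈ : ∀ {x y m} → x ≈ y → Bound x m → Bound y m
Bound-≈ x≈y x≤m n m<n = trans (sym (x≈y n)) (x≤m n m<n)

Bound-0L : ∀ m → Bound 0L m
Bound-0L m n _ = coefAt-0L n

Bound-+L : ∀ {x y m} → Bound x m → Bound y m → Bound (x +L y) m
Bound-+L {x} {y} x≤m y≤m n m<n = trans (coefAt-+L x y n) (cong₂ _+₃_ (x≤m n m<n) (y≤m n m<n))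

Bound--L : ∀ {x m} → Bound x m → Bound (-L x) m
Bound--L {x} x≤m n m<n = trans (coefAt--L x n) (cong -₃_ (x≤m n m<n))

Bound-*L : ∀ {x y m k} → Bound x m → Bound y k → Bound (x *L y) (m + k)
Bound-*L {x} {y} {m} {k} x≤m y≤k =
  Bound-≈ (*L-cong (withTop-≈ m x x≤m) (withTop-≈ k y y≤k)) (Bound-top (withTop m x *L withTop k y))

Bound-^L : ∀ {x m} n → Bound x m → Bound (x ^L n) (+ n ℤ.* m)
Bound-^L {m = m} zero    _   = Bound-mono (ℤP.≤-reflexive (sym (ℤP.*-zeroˡ m))) (Bound-top 1L)
Bound-^L {m = m} (suc n) x≤m = Bound-mono (ℤP.≤-reflexive (sym (ℤP.suc-* (+ n) m))) (Bound-*L x≤m (Bound-^L n x≤m))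

coefAt-*L-bounds : ∀ {x y m k} → Bound x m → Bound y k → coefAt (x *L y) (m + k) ≡ coefAt x m *₃ coefAt y k
coefAt-*L-bounds {x} {y} {m} {k} x≤m y≤k = begin
  coefAt (x *L y) (m + k)                          ≡⟨ *L-cong (withTop-≈ m x x≤m) (withTop-≈ k y y≤k) (m + k) ⟨
  coefAt (withTop m x *L withTop k y) (m + k)       ≡⟨ cong (coefAt (withTop m x *L withTop k y)) (ℤP.+-identityʳ (m + k)) ⟨
  coefAt (withTop m x *L withTop k y) (m + k - + 0) ≡⟨ coefAt-below (withTop m x *L withTop k y) 0 ⟩
  coefAt x (m - + 0) *₃ coefAt y (k - + 0)          ≡⟨ cong₂ _*₃_ (cong (coefAt x) (ℤP.+-identityʳ m)) (cong (coefAt y) (ℤP.+-identityʳ k)) ⟩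
  coefAt x m *₃ coefAt y k                          ∎
  where open ≡-Reasoning

Deg⇒Bound : ∀ {x d} → Deg x d → Bound x d
Deg⇒Bound = proj₂

Deg-≈ : ∀ {x y d} → x ≈ y → Deg x d → Deg y d
Deg-≈ {d = d} x≈y (x≢0 , x≤d) = (λ y≡0 → x≢0 (trans (x≈y d) y≡0)) , Bound-≈ x≈y x≤d

Deg-unique : ∀ {x d d'} → Deg x d → Deg x d' → d ≡ d'
Deg-unique {d = d} {d'} (x≢0 , x≤d) (x≢0' , x≤d') with ℤP.<-cmp d d'
... | tri< d<d' _ _ = ⊥-elim (x≢0' (x≤d d' d<d'))
... | tri≈ _ d≡d' _ = d≡d'
... | tri> _ _ d'<d = ⊥-elim (x≢0 (x≤d' d d'<d))

Deg-1L : Deg 1L (+ 0)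
Deg-1L = (λ ()) , Bound-top 1L

Deg--L : ∀ {x d} → Deg x d → Deg (-L x) d
Deg--L {x} {d} (x≢0 , x≤d) = (λ -x≡0 → x≢0 (-₃a≡0⇒a≡0 (coefAt x d) (trans (sym (coefAt--L x d)) -x≡0))) , Bound--L x≤d

Deg-+L : ∀ {x y d e} → Deg x d → Bound y e → e < d → Deg (x +L y) d
Deg-+L {x} {y} {d} (x≢0 , x≤d) y≤e e<d = x+y≢0 , Bound-+L x≤d (Bound-mono (ℤP.<⇒≤ e<d) y≤e)
  where
  x+y≢0 : ¬ coefAt (x +L y) d ≡ 0F
  x+y≢0 x+y≡0 = x≢0 (begin
    coefAt x d                ≡⟨ +₃-identityʳ (coefAt x d) ⟨
    coefAt x d +₃ 0F          ≡⟨ cong (coefAt x d +₃_) (y≤e d e<d) ⟨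
    coefAt x d +₃ coefAt y d  ≡⟨ coefAt-+L x y d ⟨
    coefAt (x +L y) d         ≡⟨ x+y≡0 ⟩
    0F                        ∎)
    where open ≡-Reasoning

Deg-*L : ∀ {x y d e} → Deg x d → Deg y e → Deg (x *L y) (d + e)
Deg-*L (x≢0 , x≤d) (y≢0 , y≤e) =
  (λ xy≡0 → a*₃b≢0 _ _ x≢0 y≢0 (trans (sym (coefAt-*L-bounds x≤d y≤e)) xy≡0)) , Bound-*L x≤d y≤e

Deg-^L : ∀ {x d} n → Deg x d → Deg (x ^L n) (+ n ℤ.* d)
Deg-^L {x} {d} zero    _   = subst (Deg 1L) (sym (ℤP.*-zeroˡ d)) Deg-1L
Deg-^L {x} {d} (suc n) x∼d = subst (Deg (x ^L suc n)) (sym (ℤP.suc-* (+ n) d)) (Deg-*L x∼d (Deg-^L n x∼d))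

Deg⊎Bound-pred : ∀ x m → Bound x m → Deg x m ⊎ Bound x (m - + 1)
Deg⊎Bound-pred x m x≤m with coefAt x m ≟₃ 0F
... | no  x≢0 = inj₁ (x≢0 , x≤m)
... | yes x≡0 = inj₂ λ n m-1<n → below-m n (subst (_≤ n) (solve 1 (λ m → con (+ 1) :+ (m :- con (+ 1)) := m) refl m)
                                                          (ℤP.i<j⇒suc[i]≤j m-1<n))
  where
  below-m : ∀ n → m ≤ n → coefAt x n ≡ 0F
  below-m n m≤n with m ℤP.≟ n
  ... | yes refl = x≡0
  ... | no  m≢n  = x≤m n (ℤP.≤∧≢⇒< m≤n m≢n)

Deg⊎Bound : ∀ x m d → Bound x m → (Σ ℤ λ j → m - + d ≤ j × Deg x j) ⊎ Bound x (m - + suc d)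
Deg⊎Bound x m zero x≤m with Deg⊎Bound-pred x m x≤m
... | inj₁ x∼m = inj₁ (m , ℤP.≤-reflexive (ℤP.+-identityʳ m) , x∼m)
... | inj₂ x≤  = inj₂ x≤
Deg⊎Bound x m (suc d) x≤m with Deg⊎Bound x m d x≤m
... | inj₁ (j , m-d≤j , x∼j) =
  inj₁ (j , ℤP.≤-trans (ℤP.+-monoʳ-≤ m (ℤP.neg-mono-≤ (ℤ.+≤+ (ℕP.n≤1+n d)))) m-d≤j , x∼j)
... | inj₂ x≤ with Deg⊎Bound-pred x (m - + suc d) x≤
...   | inj₁ x∼  = inj₁ (m - + suc d , ℤP.≤-refl , x∼)
...   | inj₂ x≤' = inj₂ (subst (Bound x) (solve 2 (λ m d → m :- d :- con (+ 1) := m :- (con (+ 1) :+ d)) refl m (+ suc d)) x≤')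

¬Bound⇒Deg : ∀ {x m lo} → Bound x m → ¬ Bound x lo → Σ ℤ λ j → lo < j × Deg x j
¬Bound⇒Deg {x} {m} {lo} x≤m x≰lo with lo ℤP.<? m
... | no lo≮m = ⊥-elim (x≰lo (Bound-mono (ℤP.≮⇒≥ lo≮m) x≤m))
... | yes lo<m with <⇒≡+suc lo<m
...   | d , refl with Deg⊎Bound x (lo + + suc d) d x≤m
...     | inj₁ (j , lo+1≤j , x∼j) = j , ℤP.<-≤-trans lo<lo+1 lo+1≤j , x∼j
  where
  lo<lo+1 : lo < lo + + suc d - + d
  lo<lo+1 = ≡+suc⇒< {k = 0} (solve 2 (λ lo d → lo :+ (con (+ 1) :+ d) :- d := lo :+ con (+ 1)) refl lo (+ d))
...     | inj₂ x≤ = ⊥-elim (x≰lo (subst (Bound x) (solve 2 (λ lo d → lo :+ d :- d := lo) refl lo (+ suc d)) x≤))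

Deg-cancelˡ : ∀ {x y c m} → Deg x c → Deg (x *L y) m → Deg y (m - c)
Deg-cancelˡ {x} {y} {c} {m} x∼c xy∼m with ¬Bound⇒Deg (Bound-top y) y≰m-c-1
  where
  y≰m-c-1 : ¬ Bound y (m - c - + 1)
  y≰m-c-1 y≤ = proj₁ xy∼m (Bound-*L (Deg⇒Bound x∼c) y≤ m
    (≡+suc⇒< {k = 0} (solve 2 (λ c m → m := c :+ (m :- c :- con (+ 1)) :+ con (+ 1)) refl c m)))
... | j , _ , y∼j = subst (Deg y) j≡m-c y∼j
  where
  j≡m-c : j ≡ m - c
  j≡m-c = trans (solve 2 (λ c j → j := c :+ j :- c) refl c j) (cong (_- c) (Deg-unique (Deg-*L x∼c y∼j) xy∼m))

IsPoly-≈ : ∀ {x y} → x ≈ y → IsPoly x → IsPoly y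
IsPoly-≈ x≈y px n n<0 = trans (sym (x≈y n)) (px n n<0)

IsPoly-0L : IsPoly 0L
IsPoly-0L n _ = coefAt-0L n

IsPoly-1L : IsPoly 1L
IsPoly-1L -[1+ _ ] _            = refl
IsPoly-1L (+ _)    (ℤ.+<+ ())

IsPoly-+L : ∀ {x y} → IsPoly x → IsPoly y → IsPoly (x +L y)
IsPoly-+L {x} {y} px py n n<0 = trans (coefAt-+L x y n) (cong₂ _+₃_ (px n n<0) (py n n<0))

IsPoly--L : ∀ {x} → IsPoly x → IsPoly (-L x)
IsPoly--L {x} px n n<0 = trans (coefAt--L x n) (cong -₃_ (px n n<0))

i<j⇒i-j<0 : ∀ {i j} → i < j → i - j < + 0
i<j⇒i-j<0 {i} {j} i<j = subst (i - j <_) (ℤP.+-inverseʳ j) (ℤP.+-monoˡ-< (- j) i<j)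

i-j<0⇒i<j : ∀ {i j} → i - j < + 0 → i < j
i-j<0⇒i<j {i} {j} i-j<0 = subst₂ _<_ (solve 2 (λ i j → i :- j :+ j := i) refl i j) (ℤP.+-identityˡ j) (ℤP.+-monoˡ-< j i-j<0)

IsPoly-*L : ∀ {x y} → IsPoly x → IsPoly y → IsPoly (x *L y)
IsPoly-*L {x} {y} px py = IsPoly-≈ (*L-cong (withTop-≈ (+ p) x (top≤ x)) (withTop-≈ (+ q) y (top≤ y))) product
  where
  p q : ℕ
  p = ∣ top x ⊔ + 0 ∣
  q = ∣ top y ⊔ + 0 ∣
  top≤ : ∀ z → Bound z (+ ∣ top z ⊔ + 0 ∣)
  top≤ z = Bound-mono (ℤP.≤-trans (ℤP.i≤i⊔j (top z) (+ 0)) (ℤP.≤-reflexive (sym (ℤP.0≤i⇒+∣i∣≡i (ℤP.i≤j⊔i (top z) (+ 0))))))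
                      (Bound-top z)
  vanish : ∀ {z} → IsPoly z → ∀ r i → r ℕ.< i → coeff (withTop (+ r) z) i ≡ 0F
  vanish pz r i r<i = pz _ (i<j⇒i-j<0 (ℤ.+<+ r<i))
  product : IsPoly (withTop (+ p) x *L withTop (+ q) y)
  product n n<0 with position (+ p + + q) n
  ... | above p+q<n = coefAt-above _ n p+q<n
  ... | below K refl = trans (coefAt-below (withTop (+ p) x *L withTop (+ q) y) K)
    (⋆-vanish-beyond (coeff (withTop (+ p) x)) (coeff (withTop (+ q) y)) p q K (vanish px p) (vanish py q) (ℤP.drop‿+<+ (subst (_< + K) (sym (ℤP.pos-+ p q)) (i-j<0⇒i<j n<0))))

IsPoly-^L : ∀ {x} n → IsPoly x → IsPoly (x ^L n)
IsPoly-^L zero    _  = IsPoly-1L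
IsPoly-^L (suc n) px = IsPoly-*L px (IsPoly-^L n px)

IsPoly∧Deg⇒0≤deg : ∀ {x d} → IsPoly x → Deg x d → + 0 ≤ d
IsPoly∧Deg⇒0≤deg {d = d} px (x≢0 , _) with + 0 ℤP.≤? d
... | yes 0≤d = 0≤d
... | no  0≰d = ⊥-elim (x≢0 (px d (ℤP.≰⇒> 0≰d)))

IsPoly⇒Deg : ∀ {x} → IsPoly x → ¬ x ≈ 0L → Σ ℤ (Deg x)
IsPoly⇒Deg {x} px x≉0 with ¬Bound⇒Deg (Bound-top x) x≰-1
  where
  x≰-1 : ¬ Bound x (- + 1)
  x≰-1 x≤-1 = x≉0 λ n → trans (vanish n) (sym (coefAt-0L n))
    where
    vanish : ∀ n → coefAt x n ≡ 0F
    vanish n with n ℤP.<? + 0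
    ... | yes n<0 = px n n<0
    ... | no  n≮0 = x≤-1 n (ℤP.<-≤-trans (ℤ.-<+ {0} {0}) (ℤP.≮⇒≥ n≮0))
... | j , _ , x∼j = j , x∼j

-- The coefficients of the inverse are solved for one at a time.
module _ {x : Laurent} {d : ℤ} (x∼d : Deg x d) where

  private
    a : Series
    a i = coefAt x (d - + i)

    a₀≢0 : ¬ a 0 ≡ 0F
    a₀≢0 a₀≡0 = proj₁ x∼d (trans (cong (coefAt x) (sym (ℤP.+-identityʳ d))) a₀≡0)

    nth : List F₃ → ℕ → F₃
    nth []       _       = 0F
    nth (c ∷ cs) zero    = c
    nth (c ∷ cs) (suc i) = nth cs i

    -- The first k + 1 coefficients of the inverse, last one first.
    reversedPrefix : ℕ → List F₃
    reversedPrefix zero    = a 0 ∷ []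
    reversedPrefix (suc k) = -₃ (a 0 *₃ sumTo (λ i → a (suc i) *₃ nth (reversedPrefix k) i) k) ∷ reversedPrefix k

    b : Series
    b k = nth (reversedPrefix k) 0

    nth-reversedPrefix : ∀ k i → i ℕ.≤ k → nth (reversedPrefix k) i ≡ b (k ∸ i)
    nth-reversedPrefix zero    zero    _         = refl
    nth-reversedPrefix (suc k) zero    _         = refl
    nth-reversedPrefix (suc k) (suc i) (s≤s i≤k) = nth-reversedPrefix k i i≤k

    b-suc : ∀ k → b (suc k) ≡ -₃ (a 0 *₃ ((λ i → a (suc i)) ⋆ b) k)
    b-suc k = cong (λ s → -₃ (a 0 *₃ s)) (sumTo-cong _ _ k λ i i≤k → cong (a (suc i) *₃_) (nth-reversedPrefix k i i≤k))

    a⋆b≡1 : ∀ k → (a ⋆ b) k ≡ coeff 1L k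
    a⋆b≡1 zero    = a*₃a≡1 (a 0) a₀≢0
    a⋆b≡1 (suc k) = trans (⋆-suc a b k) (trans (cong (λ c → (a 0 *₃ c) +₃ ((λ i → a (suc i)) ⋆ b) k) (b-suc k))
                                                  (a*₃[-a*₃s]+₃s≡0 (a 0) (((λ i → a (suc i)) ⋆ b) k) a₀≢0))

  inverse : Laurent
  inverse = mkL (- d) b

  *L-inverse : x *L inverse ≈ 1L
  *L-inverse = ≈-trans (*L-congʳ inverse (≈-sym (withTop-≈ d x (Deg⇒Bound x∼d))))
                       (≈-fromCoeff (withTop d x *L inverse) 1L (ℤP.+-inverseʳ d) a⋆b≡1)

  Bound-inverse : Bound inverse (- d)
  Bound-inverse = Bound-top inverse

^L-cong : ∀ {x y} n → x ≈ y → x ^L n ≈ y ^L n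
^L-cong zero    _   = ≈-refl
^L-cong (suc n) x≈y = *L-cong x≈y (^L-cong n x≈y)

^L-+ : ∀ x m n → x ^L (m ℕ.+ n) ≈ (x ^L m) *L (x ^L n)
^L-+ x zero    n = ≈-sym (*L-identityˡ (x ^L n))
^L-+ x (suc m) n = ≈-trans (*L-congˡ x (^L-+ x m n)) (≈-sym (*L-assoc x (x ^L m) (x ^L n)))

^L-*L : ∀ x y n → (x *L y) ^L n ≈ (x ^L n) *L (y ^L n)
^L-*L x y zero    = ≈-sym (*L-identityˡ 1L)
^L-*L x y (suc n) = ≈-trans (*L-congˡ (x *L y) (^L-*L x y n))
  (solveL 4 (λ x y a b → (x ⊗ y) ⊗ (a ⊗ b) ⊜ (x ⊗ a) ⊗ (y ⊗ b)) (λ _ → refl) x y (x ^L n) (y ^L n))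

1L-^L : ∀ n → 1L ^L n ≈ 1L
1L-^L zero    = ≈-refl
1L-^L (suc n) = ≈-trans (*L-congˡ 1L (1L-^L n)) (*L-identityˡ 1L)

^L-3^suc : ∀ x n → x ^L (3 ℕ.^ suc n) ≈ (x ^L (3 ℕ.^ n)) ^L 3
^L-3^suc x n = ≈-trans (^L-+ x N (N ℕ.+ (N ℕ.+ 0)))
  (*L-congˡ (x ^L N) (≈-trans (^L-+ x N (N ℕ.+ 0)) (*L-congˡ (x ^L N) (^L-+ x N 0))))
  where
  N : ℕ
  N = 3 ℕ.^ n

-- cExp n = (3ⁿ - (-1)ⁿ)/4, the exponent of C in b (n + 1).
cExp : ℕ → ℕ
cExp zero    = 0
cExp (suc n) = 3 ℕ.^ n ∸ cExp n

cExp≤3^ : ∀ n → cExp n ℕ.≤ 3 ℕ.^ n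
cExp≤3^ zero    = z≤n
cExp≤3^ (suc n) = ℕP.≤-trans (ℕP.m∸n≤m (3 ℕ.^ n) (cExp n)) (ℕP.m≤m+n (3 ℕ.^ n) _)

cExp+cExp-suc : ∀ n → cExp n ℕ.+ cExp (suc n) ≡ 3 ℕ.^ n
cExp+cExp-suc n = ℕP.m+[n∸m]≡n (cExp≤3^ n)

3^+[-1]^≡cExp*4 : ∀ m → + (3 ℕ.^ suc m) + (- + 1) ℤ.^ suc (suc m) ≡ + (cExp (suc m) ℕ.* 4)
3^+[-1]^≡cExp*4 zero    = refl
3^+[-1]^≡cExp*4 (suc m) = begin
  + (3 ℕ.^ suc (suc m)) + (- + 1) ℤ.* s
    ≡⟨ cong₂ (λ t u → t + (- + 1) ℤ.* u) (ℤP.pos-* 3 (3 ℕ.^ suc m)) s≡ ⟩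
  + 3 ℤ.* + t + (- + 1) ℤ.* (+ cExp (suc m) ℤ.* + 4 - + t)
    ≡⟨ solve 2 (λ t c → con (+ 3) :* t :+ con (- + 1) :* (c :* con (+ 4) :- t) := (t :- c) :* con (+ 4)) refl (+ t) (+ cExp (suc m)) ⟩
  (+ t - + cExp (suc m)) ℤ.* + 4
    ≡⟨ cong (ℤ._* + 4) (trans (ℤP.m-n≡m⊖n t (cExp (suc m))) (ℤP.⊖-≥ (cExp≤3^ (suc m)))) ⟩
  + cExp (suc (suc m)) ℤ.* + 4
    ≡⟨ ℤP.pos-* (cExp (suc (suc m))) 4 ⟨
  + (cExp (suc (suc m)) ℕ.* 4) ∎
  where
  open ≡-Reasoning
  t : ℕ
  t = 3 ℕ.^ suc m
  s : ℤ
  s = (- + 1) ℤ.^ suc (suc m)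
  s≡ : s ≡ + cExp (suc m) ℤ.* + 4 - + t
  s≡ = trans (solve 2 (λ s t → s := (t :+ s) :- t) refl s (+ t))
             (cong (_- + t) (trans (3^+[-1]^≡cExp*4 m) (ℤP.pos-* (cExp (suc m)) 4)))

expC≡cExp : ∀ m → expC (suc (suc m)) ≡ cExp (suc m)
expC≡cExp m = begin
  ∣ (+ (3 ℕ.^ suc m) + (- + 1) ℤ.^ suc (suc m)) ℤ./ + 4 ∣  ≡⟨ cong (λ z → ∣ z ℤ./ + 4 ∣) (3^+[-1]^≡cExp*4 m) ⟩
  ∣ + (cExp (suc m) ℕ.* 4) ℤ./ + 4 ∣                     ≡⟨ ℤP.abs-◃ _ _ ⟩
  1 ℕ.* ((cExp (suc m) ℕ.* 4) ℕ./ 4)                     ≡⟨ ℕP.*-identityˡ _ ⟩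
  (cExp (suc m) ℕ.* 4) ℕ./ 4                             ≡⟨ ℕD.m*n/n≡m (cExp (suc m)) 4 ⟩
  cExp (suc m)                                           ∎
  where open ≡-Reasoning

bSeq-suc : ∀ D C n → bSeq D C (suc n) ≈ (D ^L (3 ℕ.^ n)) *L (C ^L cExp n)
bSeq-suc D C zero    = solveL 2 (λ D C → D ⊜ (D ⊛ 1) ⊗ (C ⊛ 0)) (λ _ → refl) D C
bSeq-suc D C (suc m) = *L-congˡ (D ^L (3 ℕ.^ suc m)) (≈-reflexive (cong (C ^L_) (expC≡cExp m)))

≤-by : ∀ {i j} w → + 0 ≤ w → j ≡ i + w → i ≤ j
≤-by {i} w 0≤w refl = subst (_≤ i + w) (ℤP.+-identityʳ i) (ℤP.+-monoʳ-≤ i 0≤w)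

<-by : ∀ {i j} w → + 0 ≤ w → j ≡ (+ 1 + i) + w → i < j
<-by w 0≤w j≡ = ℤP.suc[i]≤j⇒i<j (≤-by w 0≤w j≡)

0≤+ : ∀ n → + 0 ≤ + n
0≤+ n = ℤ.+≤+ z≤n

0≤-+ : ∀ {x y} → + 0 ≤ x → + 0 ≤ y → + 0 ≤ x + y
0≤-+ = ℤP.+-mono-≤

0≤-* : ∀ {x y} → + 0 ≤ x → + 0 ≤ y → + 0 ≤ x ℤ.* y
0≤-* {x} {y} 0≤x 0≤y = subst (+ 0 ≤_) (cong₂ ℤ._*_ (ℤP.0≤i⇒+∣i∣≡i 0≤x) (ℤP.0≤i⇒+∣i∣≡i 0≤y))
                                (subst (+ 0 ≤_) (ℤP.pos-* ∣ x ∣ ∣ y ∣) (0≤+ _))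

quality≤4+ε : ∀ {K a q d} → + 0 ≤ K → K ℤ.* a ≤ q → + 0 ≤ d + (a + + 3 ℤ.* q) → K ℤ.* (q - d) ≤ (K ℤ.* + 4 + + 1) ℤ.* q
quality≤4+ε {K} {a} {q} {d} 0≤K Ka≤q 0≤norm with ≤⇒≡+ Ka≤q
... | v , refl = ≤-by (+ v + K ℤ.* (d + (a + + 3 ℤ.* q))) (0≤-+ (0≤+ v) (0≤-* 0≤K 0≤norm))
  (solve 4 (λ K a v d → (K :* con (+ 4) :+ con (+ 1)) :* (K :* a :+ v) :=
                        K :* ((K :* a :+ v) :- d) :+ (v :+ K :* (d :+ (a :+ con (+ 3) :* (K :* a :+ v)))))
         refl K a (+ v) d)

quality≤0 : ∀ {K q d} → + 0 ≤ K → + 0 ≤ q → q ≤ d → K ℤ.* (q - d) ≤ (K ℤ.* + 4 + + 1) ℤ.* q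
quality≤0 {K} {q} 0≤K 0≤q q≤d with ≤⇒≡+ q≤d
... | w , refl = ≤-by ((K ℤ.* + 4 + + 1) ℤ.* q + K ℤ.* + w)
  (0≤-+ (0≤-* (0≤-+ (0≤-* 0≤K (0≤+ 4)) (0≤+ 1)) 0≤q) (0≤-* 0≤K (0≤+ w)))
  (solve 3 (λ K q w → (K :* con (+ 4) :+ con (+ 1)) :* q := K :* (q :- (q :+ w)) :+ ((K :* con (+ 4) :+ con (+ 1)) :* q :+ K :* w))
         refl K q (+ w))

quality≥4-ε : ∀ {K q c} → + 0 ≤ K → + 0 ≤ q → + 0 ≤ c → (K ℤ.* + 4 - + 1) ℤ.* q ≤ K ℤ.* (q - - (+ 3 ℤ.* q + c))
quality≥4-ε {K} {q} {c} 0≤K 0≤q 0≤c = ≤-by (K ℤ.* c + q) (0≤-+ (0≤-* 0≤K 0≤c) 0≤q)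
  (solve 3 (λ K q c → K :* (q :- :- (con (+ 3) :* q :+ c)) := (K :* con (+ 4) :- con (+ 1)) :* q :+ (K :* c :+ q)) refl K q c)

i≤+∣i∣ : ∀ i → i ≤ + ∣ i ∣
i≤+∣i∣ (+ _)    = ℤP.≤-refl
i≤+∣i∣ -[1+ _ ] = ℤ.-≤+

module Theorem4
  (A C D β : Laurent) (dA dC : ℤ) (δ : ℕ) (dA≡ : dA ≡ dC + + suc δ)
  (pA : IsPoly A) (pC : IsPoly C) (pD : IsPoly D)
  (C∼dC : Deg C dC) (A∼dA : Deg A dA) (A≈CD : A ≈ C *L D)
  (equation : (-L (β ^L 4)) -L (A *L β) +L C ≈ 0L) (β-small : SmallL β) where

  b : ℤ
  b = + suc δ

  0≤dC : + 0 ≤ dC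
  0≤dC = IsPoly∧Deg⇒0≤deg pC C∼dC

  0≤dA : + 0 ≤ dA
  0≤dA = subst (+ 0 ≤_) (sym dA≡) (0≤-+ 0≤dC (0≤+ (suc δ)))

  C≈β⁴+Aβ : C ≈ (β ^L 4) +L (A *L β)
  C≈β⁴+Aβ = ≈+0
    (solveL 3 (λ β A C → C ⊜ ((β ⊛ 4) ⊕ (A ⊗ β)) ⊕ (((⊝ (β ⊛ 4)) ⊖ (A ⊗ β)) ⊕ C)) (λ _ → refl) β A C)
    equation

  β*[A+β³]≈C : β *L (A +L β ^L 3) ≈ C
  β*[A+β³]≈C = ≈-trans (solveL 2 (λ β A → β ⊗ (A ⊕ β ⊛ 3) ⊜ (β ⊛ 4) ⊕ (A ⊗ β)) (λ _ → refl) β A) (≈-sym C≈β⁴+Aβ)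

  β≤-1 : Bound β (- + 1)
  β≤-1 n -1<n = β-small n (ℤP.i<j⇒suc[i]≤j -1<n)

  β∼-b : Deg β (- b)
  β∼-b = subst (Deg β) (trans (cong (λ a → dC - a) dA≡) (solve 2 (λ dC b → dC :- (dC :+ b) := :- b) refl dC b))
    (Deg-cancelˡ (Deg-+L A∼dA (Bound-^L 3 β≤-1) (ℤP.<-≤-trans ℤ.-<+ 0≤dA))
                 (Deg-≈ (≈-sym (≈-trans (*L-comm (A +L β ^L 3) β) β*[A+β³]≈C)) C∼dC))

  C⁻¹ : Laurent
  C⁻¹ = inverse C∼dC

  C^m*C⁻¹^m≈1 : ∀ m → (C ^L m) *L (C⁻¹ ^L m) ≈ 1L
  C^m*C⁻¹^m≈1 m = ≈-trans (≈-sym (^L-*L C C⁻¹ m)) (≈-trans (^L-cong m (*L-inverse C∼dC)) (1L-^L m))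

  u : ℕ → Laurent
  u n = β ^L (3 ℕ.^ n)

  -- In characteristic 3 cubing is a ring endomorphism, so β (A + β³) = C survives
  -- being raised to the power 3ⁿ.
  u*[A^+u³]≈C^ : ∀ n → u n *L ((A ^L (3 ℕ.^ n)) +L u n ^L 3) ≈ C ^L (3 ℕ.^ n)
  u*[A^+u³]≈C^ zero = begin
    (β ^L 1) *L ((A ^L 1) +L (β ^L 1) ^L 3)
      ≈⟨ solveL 2 (λ β A → (β ⊛ 1) ⊗ ((A ⊛ 1) ⊕ (β ⊛ 1) ⊛ 3) ⊜ β ⊗ (A ⊕ β ⊛ 3)) (λ _ → refl) β A ⟩
    β *L (A +L β ^L 3)  ≈⟨ β*[A+β³]≈C ⟩
    C                   ≈⟨ *L-identityʳ C ⟨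
    C ^L 1              ∎
    where open ≈-Reasoning
  u*[A^+u³]≈C^ (suc n) = begin
    u (suc n) *L ((A ^L (3 ℕ.^ suc n)) +L u (suc n) ^L 3)
      ≈⟨ *L-cong (^L-3^suc β n) (+L-cong (^L-3^suc A n) (^L-cong 3 (^L-3^suc β n))) ⟩
    (u n ^L 3) *L ((A ^L (3 ℕ.^ n)) ^L 3 +L (u n ^L 3) ^L 3)
      ≈⟨ solveL 2 (λ x a → (x ⊛ 3) ⊗ ((a ⊛ 3) ⊕ (x ⊛ 3) ⊛ 3) ⊜ (x ⊗ (a ⊕ x ⊛ 3)) ⊛ 3) (λ _ → refl) (u n) (A ^L (3 ℕ.^ n)) ⟩
    (u n *L ((A ^L (3 ℕ.^ n)) +L u n ^L 3)) ^L 3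
      ≈⟨ ^L-cong 3 (u*[A^+u³]≈C^ n) ⟩
    (C ^L (3 ℕ.^ n)) ^L 3
      ≈⟨ ^L-3^suc C n ⟨
    C ^L (3 ℕ.^ suc n) ∎
    where open ≈-Reasoning

  completeQuotient : ℕ → Laurent
  completeQuotient n = bSeq D C n +L (u n *L (C⁻¹ ^L cExp n))

  completeQuotient-0 : completeQuotient 0 ≈ β
  completeQuotient-0 = ≈-trans (+L-identityˡ _) (solveL 1 (λ β → (β ⊛ 1) ⊗ (β ⊛ 0) ⊜ β) (λ _ → refl) β)

  completeQuotient-bSeq : ∀ n → completeQuotient n -L bSeq D C n ≈ u n *L (C⁻¹ ^L cExp n)
  completeQuotient-bSeq n = solveL 2 (λ B w → (B ⊕ w) ⊖ B ⊜ w) (λ _ → refl) (bSeq D C n) (u n *L (C⁻¹ ^L cExp n))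

  completeQuotient-step : ∀ n → (completeQuotient n -L bSeq D C n) *L completeQuotient (suc n) ≈ 1L
  completeQuotient-step n = begin
    (completeQuotient n -L bSeq D C n) *L completeQuotient (suc n)
      ≈⟨ *L-cong (completeQuotient-bSeq n) (+L-cong (bSeq-suc D C n) (*L-congʳ q (^L-3^suc β n))) ⟩
    (v *L p) *L ((w *L r) +L ((v ^L 3) *L q))
      ≈⟨ solveL 5 (λ v p w r q → (v ⊗ p) ⊗ ((w ⊗ r) ⊕ ((v ⊛ 3) ⊗ q)) ⊜ (v ⊗ w) ⊗ (r ⊗ p) ⊕ (v ⊗ (v ⊛ 3)) ⊗ (p ⊗ q)) (λ _ → refl) v p w r q ⟩
    ((v *L w) *L (r *L p)) +L ((v *L (v ^L 3)) *L (p *L q))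
      ≈⟨ +L-cong (*L-congˡ (v *L w) (C^m*C⁻¹^m≈1 (cExp n)))
                 (*L-congˡ (v *L (v ^L 3)) (≈-trans (≈-sym (^L-+ C⁻¹ (cExp n) (cExp (suc n))))
                                                    (≈-reflexive (cong (C⁻¹ ^L_) (cExp+cExp-suc n))))) ⟩
    ((v *L w) *L 1L) +L ((v *L (v ^L 3)) *L c⁻¹)
      ≈⟨ +L-cong (*L-congˡ (v *L w) (≈-sym (C^m*C⁻¹^m≈1 (3 ℕ.^ n)))) (≈-refl {(v *L (v ^L 3)) *L c⁻¹}) ⟩
    ((v *L w) *L (c *L c⁻¹)) +L ((v *L (v ^L 3)) *L c⁻¹)
      ≈⟨ solveL 4 (λ v w c c⁻¹ → ((v ⊗ w) ⊗ (c ⊗ c⁻¹)) ⊕ ((v ⊗ (v ⊛ 3)) ⊗ c⁻¹) ⊜ (v ⊗ ((c ⊗ w) ⊕ v ⊛ 3)) ⊗ c⁻¹) (λ _ → refl) v w c c⁻¹ ⟩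
    (v *L ((c *L w) +L v ^L 3)) *L c⁻¹
      ≈⟨ *L-congʳ c⁻¹ (*L-congˡ v (+L-cong (≈-trans (≈-sym (^L-*L C D (3 ℕ.^ n))) (^L-cong (3 ℕ.^ n) (≈-sym A≈CD))) (≈-refl {v ^L 3}))) ⟩
    (v *L ((A ^L (3 ℕ.^ n)) +L v ^L 3)) *L c⁻¹
      ≈⟨ *L-congʳ c⁻¹ (u*[A^+u³]≈C^ n) ⟩
    c *L c⁻¹
      ≈⟨ C^m*C⁻¹^m≈1 (3 ℕ.^ n) ⟩
    1L ∎
    where
    open ≈-Reasoning
    v p q w r c c⁻¹ : Laurent
    v = u n
    p = C⁻¹ ^L cExp n
    q = C⁻¹ ^L cExp (suc n)
    w = D ^L (3 ℕ.^ n)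
    r = C ^L cExp n
    c = C ^L (3 ℕ.^ n)
    c⁻¹ = C⁻¹ ^L (3 ℕ.^ n)

  remainder-exponent<0 : ∀ t c → 0 ℕ.< t → + t ℤ.* (- b) + + c ℤ.* (- dC) < + 0
  remainder-exponent<0 (suc t) c _ = <-by (+ t ℤ.* b + + δ + + c ℤ.* dC)
    (0≤-+ (0≤-+ (0≤-* (0≤+ t) (0≤+ (suc δ))) (0≤+ δ)) (0≤-* (0≤+ c) 0≤dC))
    (solve 4 (λ t δ c dC → con (+ 0) := (con (+ 1) :+ ((con (+ 1) :+ t) :* (:- (con (+ 1) :+ δ)) :+ c :* (:- dC)))
                                         :+ (t :* (con (+ 1) :+ δ) :+ δ :+ c :* dC)) refl (+ t) (+ δ) (+ c) dC)

  completeQuotient-bSeq-small : ∀ n → SmallL (completeQuotient n -L bSeq D C n)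
  completeQuotient-bSeq-small n m 0≤m = Bound-≈ (≈-sym (completeQuotient-bSeq n))
    (Bound-*L (Bound-^L (3 ℕ.^ n) (Deg⇒Bound β∼-b)) (Bound-^L (cExp n) (Bound-inverse C∼dC))) m
    (ℤP.<-≤-trans (remainder-exponent<0 (3 ℕ.^ n) (cExp n) (ℕP.m^n>0 3 n)) 0≤m)

  bSeq-IsPoly : ∀ n → IsPoly (bSeq D C n)
  bSeq-IsPoly zero                = IsPoly-0L
  bSeq-IsPoly (suc zero)          = pD
  bSeq-IsPoly n@(suc (suc _))     = IsPoly-*L (IsPoly-^L (3 ℕ.^ (n ∸ 1)) pD) (IsPoly-^L (expC n) pC)

  β-expansion : IsCFExpansion β (bSeq D C)
  β-expansion = completeQuotient , completeQuotient-0 , λ n → bSeq-IsPoly n , completeQuotient-bSeq-small n , completeQuotient-step n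

  cofactor : Laurent → Laurent → Laurent
  cofactor P Q = A *L Q ^L 3 +L ((Q *L β) ^L 3 +L (Q *L β) *L ((Q *L β) *L P) +L (Q *L β) *L (P *L P) +L P ^L 3)

  -- The norm form of β, evaluated at (P, Q), vanishes for P/Q = β.
  norm≈error*cofactor : ∀ P Q → (-L (P ^L 4)) -L (A *L P *L Q ^L 3) +L (C *L Q ^L 4) ≈ (Q *L β -L P) *L cofactor P Q
  norm≈error*cofactor P Q = ≈+0
    (solveL 5 (λ P Q β A C → ((⊝ (P ⊛ 4)) ⊖ (A ⊗ P ⊗ Q ⊛ 3)) ⊕ (C ⊗ Q ⊛ 4) ⊜
       ((Q ⊗ β) ⊖ P) ⊗ ((A ⊗ Q ⊛ 3) ⊕ ((Q ⊗ β) ⊛ 3 ⊕ (Q ⊗ β) ⊗ ((Q ⊗ β) ⊗ P) ⊕ (Q ⊗ β) ⊗ (P ⊗ P) ⊕ P ⊛ 3))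
       ⊕ ((Q ⊛ 4) ⊗ (C ⊖ ((β ⊛ 4) ⊕ (A ⊗ β))))) (λ _ → refl) P Q β A C)
    (≈-trans (*L-congˡ (Q ^L 4) (≈-trans (+L-cong C≈β⁴+Aβ (≈-refl { -L ((β ^L 4) +L (A *L β))}))
                                         (-L-inverseʳ ((β ^L 4) +L (A *L β)))))
             (*L-zeroʳ (Q ^L 4)))

  Deg-cofactor : ∀ {P Q dQ} → Deg Q dQ → Bound P (dQ - + 1) → Deg (cofactor P Q) (dA + + 3 ℤ.* dQ)
  Deg-cofactor {P} {Q} {dQ} Q∼dQ P≤ = Deg-+L (Deg-*L A∼dA (Deg-^L 3 Q∼dQ)) rest≤ (<-by (dA + + 2) (0≤-+ 0≤dA (0≤+ 2))
    (solve 2 (λ a q → a :+ con (+ 3) :* q := (con (+ 1) :+ ((q :- con (+ 1)) :+ ((q :- con (+ 1)) :+ (q :- con (+ 1))))) :+ (a :+ con (+ 2))) refl dA dQ))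
    where
    m : ℤ
    m = dQ - + 1
    Qβ≤ : Bound (Q *L β) m
    Qβ≤ = Bound-*L (Deg⇒Bound Q∼dQ) β≤-1
    cube≤ : ∀ {x y z} → Bound x m → Bound y m → Bound z m → Bound (x *L (y *L z)) (m + (m + m))
    cube≤ x≤ y≤ z≤ = Bound-*L x≤ (Bound-*L y≤ z≤)
    x³≈ : ∀ x → x ^L 3 ≈ x *L (x *L x)
    x³≈ x = *L-congˡ x (*L-congˡ x (*L-identityʳ x))
    rest≤ : Bound ((Q *L β) ^L 3 +L (Q *L β) *L ((Q *L β) *L P) +L (Q *L β) *L (P *L P) +L P ^L 3) (m + (m + m))
    rest≤ = Bound-+L (Bound-+L (Bound-+L (Bound-≈ (≈-sym (x³≈ (Q *L β))) (cube≤ Qβ≤ Qβ≤ Qβ≤)) (cube≤ Qβ≤ Qβ≤ P≤))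
                               (cube≤ Qβ≤ P≤ P≤))
                     (Bound-≈ (≈-sym (x³≈ P)) (cube≤ P≤ P≤ P≤))

  liouville : ∀ {P Q dQ d} → IsPoly P → IsPoly Q → Deg Q dQ → Deg (Q *L β -L P) d → d < dQ →
              + 0 ≤ d + (dA + + 3 ℤ.* dQ)
  liouville {P} {Q} {dQ} {d} pP pQ Q∼dQ error∼d d<dQ = IsPoly∧Deg⇒0≤deg norm-IsPoly
    (Deg-≈ (≈-sym (norm≈error*cofactor P Q)) (Deg-*L error∼d (Deg-cofactor Q∼dQ P≤)))
    where
    norm-IsPoly : IsPoly ((-L (P ^L 4)) -L (A *L P *L Q ^L 3) +L (C *L Q ^L 4))
    norm-IsPoly = IsPoly-+L (IsPoly-+L (IsPoly--L (IsPoly-^L 4 pP)) (IsPoly--L (IsPoly-*L (IsPoly-*L pA pP) (IsPoly-^L 3 pQ))))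
                            (IsPoly-*L pC (IsPoly-^L 4 pQ))
    d≤dQ-1 : d ≤ dQ - + 1
    d≤dQ-1 = subst (d ≤_) (ℤP.+-comm (- + 1) dQ) (ℤP.i<j⇒i≤pred[j] d<dQ)
    P≤ : Bound P (dQ - + 1)
    P≤ = Bound-≈ (≈-sym (solveL 2 (λ P Qβ → P ⊜ Qβ ⊖ (Qβ ⊖ P)) (λ _ → refl) P (Q *L β)))
                 (Bound-+L (Bound-*L (Deg⇒Bound Q∼dQ) β≤-1) (Bound--L (Bound-mono d≤dQ-1 (Deg⇒Bound error∼d))))

  measure-upper : ∀ (j : ℕ) → ∃ λ (N : ℤ) → ∀ (P Q : Laurent) (dQ d : ℤ) →
    IsPoly P → IsPoly Q → Deg Q dQ → Deg (Q *L β -L P) d → N ≤ dQ →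
    + suc j ℤ.* (dQ - d) ≤ + (suc j ℕ.* 4 ℕ.+ 1) ℤ.* dQ
  measure-upper j = + suc j ℤ.* dA , bound
    where
    [1+j]*4+1≡ : + (suc j ℕ.* 4 ℕ.+ 1) ≡ + suc j ℤ.* + 4 + + 1
    [1+j]*4+1≡ = trans (ℤP.pos-+ (suc j ℕ.* 4) 1) (cong (_+ + 1) (ℤP.pos-* (suc j) 4))
    bound : ∀ P Q dQ d → IsPoly P → IsPoly Q → Deg Q dQ → Deg (Q *L β -L P) d → + suc j ℤ.* dA ≤ dQ →
            + suc j ℤ.* (dQ - d) ≤ + (suc j ℕ.* 4 ℕ.+ 1) ℤ.* dQ
    bound P Q dQ d pP pQ Q∼dQ error∼d KdA≤dQ = subst (λ c → + suc j ℤ.* (dQ - d) ≤ c ℤ.* dQ) (sym [1+j]*4+1≡) (by-cases (d ℤP.<? dQ))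
      where
      by-cases : Dec (d < dQ) → + suc j ℤ.* (dQ - d) ≤ (+ suc j ℤ.* + 4 + + 1) ℤ.* dQ
      by-cases (yes d<dQ) = quality≤4+ε (0≤+ (suc j)) KdA≤dQ (liouville pP pQ Q∼dQ error∼d d<dQ)
      by-cases (no  d≮dQ) = quality≤0 (0≤+ (suc j)) (ℤP.≤-trans (0≤-* (0≤+ (suc j)) 0≤dA) KdA≤dQ) (ℤP.≮⇒≥ d≮dQ)

  -- The approximations built below have numerators P = C X.
  error : Laurent → Laurent → Laurent
  error X Q = Q *L β -L C *L X

  Q₁ : Laurent → Laurent → Laurent
  Q₁ X Q = D *L Q ^L 3 +L (C *L C) *L X ^L 3

  next : Laurent × Laurent → Laurent × Laurent
  next (X , Q) = Q₁ X Q ^L 3 , A *L Q₁ X Q ^L 3 +L Q ^L 9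

  approximation : ℕ → Laurent × Laurent
  approximation zero    = 0L , 1L
  approximation (suc n) = next (approximation n)

  CD-A≈0 : (C *L D) -L A ≈ 0L
  CD-A≈0 = ≈-trans (+L-cong (≈-sym A≈CD) (≈-refl { -L A})) (-L-inverseʳ A)

  β⁴+Aβ-C≈0 : ((β ^L 4) +L (A *L β)) -L C ≈ 0L
  β⁴+Aβ-C≈0 = ≈-trans (+L-cong (≈-sym C≈β⁴+Aβ) (≈-refl { -L C})) (-L-inverseʳ C)

  -- Each half step cubes the error (up to the factor -β): the cubes of P/Q approximate β³ = C/β - A
  -- and D = A/C turns this back into an approximation of β.
  C*error₁≈ : ∀ X Q → C *L (Q₁ X Q *L β -L Q ^L 3) ≈ -L (β *L error X Q ^L 3)
  C*error₁≈ X Q = ≈+0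
    (solveL 6 (λ C D A β Q X →
       C ⊗ ((((D ⊗ Q ⊛ 3) ⊕ ((C ⊗ C) ⊗ X ⊛ 3)) ⊗ β) ⊖ Q ⊛ 3) ⊜
       (⊝ (β ⊗ ((Q ⊗ β) ⊖ (C ⊗ X)) ⊛ 3)) ⊕ ((Q ⊛ 3) ⊗ ((β ⊗ ((C ⊗ D) ⊖ A)) ⊕ (((β ⊛ 4) ⊕ (A ⊗ β)) ⊖ C))))
       (λ _ → refl) C D A β Q X)
    (≈-trans (*L-congˡ (Q ^L 3) (≈-trans (+L-cong (≈-trans (*L-congˡ β CD-A≈0) (*L-zeroʳ β)) β⁴+Aβ-C≈0) (+L-identityʳ 0L)))
             (*L-zeroʳ (Q ^L 3)))

  error-next≈ : ∀ X Q → error (Q₁ X Q ^L 3) (A *L Q₁ X Q ^L 3 +L Q ^L 9) ≈ -L (β *L (Q₁ X Q *L β -L Q ^L 3) ^L 3)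
  error-next≈ X Q = ≈+0
    (solveL 5 (λ A C β Q₁ Q →
       ((((A ⊗ Q₁ ⊛ 3) ⊕ Q ⊛ 9) ⊗ β) ⊖ (C ⊗ Q₁ ⊛ 3)) ⊜
       (⊝ (β ⊗ ((Q₁ ⊗ β) ⊖ Q ⊛ 3) ⊛ 3)) ⊕ ((Q₁ ⊛ 3) ⊗ (((β ⊛ 4) ⊕ (A ⊗ β)) ⊖ C)))
       (λ _ → refl) A C β (Q₁ X Q) Q)
    (≈-trans (*L-congˡ (Q₁ X Q ^L 3) β⁴+Aβ-C≈0) (*L-zeroʳ (Q₁ X Q ^L 3)))

  D∼b : Deg D b
  D∼b = subst (Deg D) (trans (cong (_- dC) dA≡) (solve 2 (λ dC b → dC :+ b :- dC := b) refl dC b))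
              (Deg-cancelˡ C∼dC (Deg-≈ A≈CD A∼dA))

  record Good (n : ℕ) (X Q : Laurent) (q : ℤ) : Set where
    field
      X-poly : IsPoly X
      Q-poly : IsPoly Q
      Q∼q    : Deg Q q
      X≤     : Bound X (q - dA)
      error∼ : Deg (error X Q) (- (+ 3 ℤ.* q + b))
      n≤q    : + n ≤ q

  good-0 : Good 0 0L 1L (+ 0)
  good-0 = record
    { X-poly = IsPoly-0L ; Q-poly = IsPoly-1L ; Q∼q = Deg-1L ; X≤ = Bound-0L _
    ; error∼ = Deg-≈ (≈-sym error≈β) (subst (Deg β) (cong -_ (sym (ℤP.+-identityˡ b))) β∼-b)
    ; n≤q = ℤP.≤-refl }
    where
    -L0L≈0L : -L 0L ≈ 0L
    -L0L≈0L n = trans (coefAt--L 0L n) (trans (cong -₃_ (coefAt-0L n)) (sym (coefAt-0L n)))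
    error≈β : error 0L 1L ≈ β
    error≈β = ≈+0 (+L-cong (*L-identityˡ β) (≈-refl { -L (C *L 0L)})) (≈-trans (-L-cong (*L-zeroʳ C)) -L0L≈0L)

  good-next : ∀ {n X Q q} → Good n X Q q → Good (suc n) (Q₁ X Q ^L 3) (A *L Q₁ X Q ^L 3 +L Q ^L 9) (dA + + 3 ℤ.* (b + + 3 ℤ.* q))
  good-next {n} {X} {Q} {q} g = record
    { X-poly = IsPoly-^L 3 Q₁-poly
    ; Q-poly = IsPoly-+L (IsPoly-*L pA (IsPoly-^L 3 Q₁-poly)) (IsPoly-^L 9 Q-poly)
    ; Q∼q    = Deg-+L (Deg-*L A∼dA (Deg-^L 3 Q₁∼)) (Bound-^L 9 (Deg⇒Bound Q∼q)) Q⁹-lower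
    ; X≤     = Bound-mono (ℤP.≤-reflexive (solve 2 (λ dA x → con (+ 3) :* x := dA :+ con (+ 3) :* x :- dA) refl dA (b + + 3 ℤ.* q)))
                          (Bound-^L 3 (Deg⇒Bound Q₁∼))
    ; error∼ = subst (Deg _) error-exponent (Deg-≈ (≈-sym (error-next≈ X Q)) (Deg--L (Deg-*L β∼-b (Deg-^L 3 error₁∼))))
    ; n≤q    = ≤-by (dA + + 3 ℤ.* + δ + + 2 + + 8 ℤ.* q + (q - + n))
                 (0≤-+ (0≤-+ (0≤-+ (0≤-+ 0≤dA (0≤-* (0≤+ 3) (0≤+ δ))) (0≤+ 2)) (0≤-* (0≤+ 8) 0≤q)) (ℤP.i≤j⇒0≤j-i n≤q))
                 (solve 4 (λ dA δ q n → dA :+ con (+ 3) :* ((con (+ 1) :+ δ) :+ con (+ 3) :* q) :=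
                                       (con (+ 1) :+ n) :+ (dA :+ con (+ 3) :* δ :+ con (+ 2) :+ con (+ 8) :* q :+ (q :- n)))
                        refl dA (+ δ) q (+ n)) }
    where
    open Good g
    0≤q : + 0 ≤ q
    0≤q = IsPoly∧Deg⇒0≤deg Q-poly Q∼q
    Q₁-poly : IsPoly (Q₁ X Q)
    Q₁-poly = IsPoly-+L (IsPoly-*L pD (IsPoly-^L 3 Q-poly)) (IsPoly-*L (IsPoly-*L pC pC) (IsPoly-^L 3 X-poly))
    Q₁∼ : Deg (Q₁ X Q) (b + + 3 ℤ.* q)
    Q₁∼ = Deg-+L (Deg-*L D∼b (Deg-^L 3 Q∼q)) (Bound-*L (Bound-*L (Deg⇒Bound C∼dC) (Deg⇒Bound C∼dC)) (Bound-^L 3 X≤))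
      (<-by (dC + + 4 ℤ.* + δ + + 3) (0≤-+ (0≤-+ 0≤dC (0≤-* (0≤+ 4) (0≤+ δ))) (0≤+ 3))
        (trans (solve 3 (λ dC δ q → (con (+ 1) :+ δ) :+ con (+ 3) :* q :=
                          (con (+ 1) :+ ((dC :+ dC) :+ con (+ 3) :* (q :- (dC :+ (con (+ 1) :+ δ))))) :+ (dC :+ con (+ 4) :* δ :+ con (+ 3)))
                        refl dC (+ δ) q)
               (cong (λ a → (+ 1 + ((dC + dC) + + 3 ℤ.* (q - a))) + (dC + + 4 ℤ.* + δ + + 3)) (sym dA≡))))
    error₁∼ : Deg (Q₁ X Q *L β -L Q ^L 3) ((- b + + 3 ℤ.* (- (+ 3 ℤ.* q + b))) - dC)
    error₁∼ = Deg-cancelˡ C∼dC (Deg-≈ (≈-sym (C*error₁≈ X Q)) (Deg--L (Deg-*L β∼-b (Deg-^L 3 error∼))))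
    Q⁹-lower : + 9 ℤ.* q < dA + + 3 ℤ.* (b + + 3 ℤ.* q)
    Q⁹-lower = <-by (dA + + 3 ℤ.* + δ + + 2) (0≤-+ (0≤-+ 0≤dA (0≤-* (0≤+ 3) (0≤+ δ))) (0≤+ 2))
      (solve 3 (λ dA δ q → dA :+ con (+ 3) :* ((con (+ 1) :+ δ) :+ con (+ 3) :* q) :=
                           (con (+ 1) :+ con (+ 9) :* q) :+ (dA :+ con (+ 3) :* δ :+ con (+ 2))) refl dA (+ δ) q)
    error-exponent : - b + + 3 ℤ.* ((- b + + 3 ℤ.* (- (+ 3 ℤ.* q + b))) - dC)
                   ≡ - (+ 3 ℤ.* (dA + + 3 ℤ.* (b + + 3 ℤ.* q)) + b)
    error-exponent = trans (solve 3 (λ dC b q → :- b :+ con (+ 3) :* ((:- b :+ con (+ 3) :* (:- (con (+ 3) :* q :+ b))) :- dC)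
                                              := :- (con (+ 3) :* ((dC :+ b) :+ con (+ 3) :* (b :+ con (+ 3) :* q)) :+ b))
                                   refl dC b q)
                           (cong (λ a → - (+ 3 ℤ.* (a + + 3 ℤ.* (b + + 3 ℤ.* q)) + b)) (sym dA≡))

  degQ : ℕ → ℤ
  degQ zero    = + 0
  degQ (suc n) = dA + + 3 ℤ.* (b + + 3 ℤ.* degQ n)

  good : ∀ n → Good n (proj₁ (approximation n)) (proj₂ (approximation n)) (degQ n)
  good zero    = good-0
  good (suc n) = good-next (good n)

  measure-lower : ∀ (j : ℕ) (N : ℤ) → Σ Laurent λ P → Σ Laurent λ Q → Σ ℤ λ dQ → Σ ℤ λ d →
    IsPoly P × IsPoly Q × Deg Q dQ × Deg (Q *L β -L P) d × N ≤ dQ ×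
    ((+ (suc j ℕ.* 4) - + 1) ℤ.* dQ ≤ + suc j ℤ.* (dQ - d))
  measure-lower j N =
    C *L X , Q , degQ ∣ N ∣ , - (+ 3 ℤ.* degQ ∣ N ∣ + b) ,
    IsPoly-*L pC X-poly , Q-poly , Q∼q , error∼ , ℤP.≤-trans (i≤+∣i∣ N) n≤q ,
    subst (λ c → (c - + 1) ℤ.* degQ ∣ N ∣ ≤ + suc j ℤ.* (degQ ∣ N ∣ - - (+ 3 ℤ.* degQ ∣ N ∣ + b))) (sym (ℤP.pos-* (suc j) 4))
          (quality≥4-ε (0≤+ (suc j)) (IsPoly∧Deg⇒0≤deg Q-poly Q∼q) (0≤+ (suc δ)))
    where
    X Q : Laurent
    X = proj₁ (approximation ∣ N ∣)
    Q = proj₂ (approximation ∣ N ∣)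
    open Good (good ∣ N ∣)

  β-measure : IrrMeasureIs β 4
  β-measure = measure-upper , measure-lower

theorem4 : ∀ (A C : Laurent) →
    IsPoly A → IsPoly C → ¬ (A ≈ 0L) → ¬ (C ≈ 0L) →
    (∀ (dA dC : ℤ) → Deg A dA → Deg C dC → dC ℤ.< dA) →
    (∃ λ D → IsPoly D × (A ≈ C *L D)) →
    ∀ (β : Laurent) → Irrational β →
    ((-L (β ^L 4)) -L (A *L β) +L C ≈ 0L) → SmallL β →
    ∀ (D : Laurent) → IsPoly D → A ≈ C *L D →
    IsCFExpansion β (bSeq D C) × IrrMeasureIs β 4
theorem4 A C pA pC A≉0 C≉0 deg-C<deg-A _ β _ equation β-small D pD A≈CD = β-expansion , β-measure
  where
  A-degree : Σ ℤ (Deg A)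
  A-degree = IsPoly⇒Deg pA A≉0
  C-degree : Σ ℤ (Deg C)
  C-degree = IsPoly⇒Deg pC C≉0
  deg-A-decomposition : Σ ℕ λ δ → proj₁ A-degree ≡ proj₁ C-degree + + suc δ
  deg-A-decomposition = <⇒≡+suc (deg-C<deg-A _ _ (proj₂ A-degree) (proj₂ C-degree))
  open Theorem4 A C D β (proj₁ A-degree) (proj₁ C-degree) (proj₁ deg-A-decomposition) (proj₂ deg-A-decomposition)
                pA pC pD (proj₂ C-degree) (proj₂ A-degree) A≈CD equation β-small
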